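{- As $t$-shuffle algebras (i.e. with respect to $\overset{t}{\sqcup\!\sqcup}$), we have $\mathfrak{h}_t^1=\mathfrak{h}_t^0[y]$. Similarly, as $t$-harmonic shuffle algebras (i.e. with respect to $\overset{t}{\ast}$), we have $\mathfrak{h}_t^1=\mathfrak{h}_t^0[y]$.
   Context: Let $A=\{x,y\}$ be an alphabet of two noncommutative letters, $A^{\ast}$ the set of words (including the empty word $1$), $\mathfrak{h}_t=\mathbb{Q}[t]\langle A\rangle$, $\mathfrak{h}_t^1=\mathbb{Q}[t]+\mathfrak{h}_ty$, $\mathfrak{h}_t^0=\mathbb{Q}[t]+x\mathfrak{h}_ty$, and $z_k=x^{k-1}y$. The $t$-shuffle product $\overset{t}{\sqcup\!\sqcup}$ is the $\mathbb{Q}[t]$-bilinear product on $\mathfrak{h}_t$ with $1\overset{t}{\sqcup\!\sqcup} w=w\overset{t}{\sqcup\!\sqcup} 1=w$ and $aw_1\overset{t}{\sqcup\!\sqcup} bw_2=a(w_1\overset{t}{\sqcup\!\sqcup} bw_2)+b(aw_1\overset{t}{\sqcup\!\sqcup} w_2)-\delta(w_1)\rho(a)bw_2-\delta(w_2)\rho(b)aw_1$ for $w,w_1,w_2\in A^\ast$, $a,b\in A$, where $\delta(w)=1$ if $w=1$ and $0$ otherwise, and $\rho(x)=0$, $\rho(y)=tx$. The $t$-harmonic product $\overset{t}{\ast}$ on $\mathfrak{h}_t^1$ is the $\mathbb{Q}[t]$-bilinear product with $1\overset{t}{\ast} w=w\overset{t}{\ast} 1=w$ and $z_kw_1\overset{t}{\ast}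 z_lw_2=z_k(w_1\overset{t}{\ast} z_lw_2)+z_l(z_kw_1\overset{t}{\ast} w_2)+(1-2t)z_{k+l}(w_1\overset{t}{\ast} w_2)+(1-\delta(w_1)\delta(w_2))(t^2-t)x^{k+l}(w_1\overset{t}{\ast} w_2)$ for words $w,w_1,w_2\in A^\ast\cap\mathfrak{h}_t^1$, $k,l\geqslant1$. Both products are commutative and associative, and $\mathfrak{h}_t^0\subset\mathfrak{h}_t^1$ are subalgebras for each. -}

module Defs where

open import Data.Nat using (ℕ; zero; suc; _+_)
import Data.Nat as ℕ
open import Data.Rational using (ℚ; 0ℚ; 1ℚ; -_) renaming (_+_ to _+ℚ_; _*_ to _*ℚ_)
open import Data.List using (List; []; _∷_; _++_; [_]; map; concatMap; replicate)
open import Data.List.Relation.Unary.All using (All)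
open import Data.Maybe using (Maybe; just; nothing; _>>=_)
import Data.Maybe as Maybe
open import Data.Product using (_×_; _,_; ∃-syntax)
open import Data.Sum using (_⊎_)
open import Data.Unit using (⊤)
open import Data.Empty using (⊥)
open import Data.Bool using (Bool; true; false; if_then_else_; _∧_; not)
open import Relation.Nullary using (¬_; does)
open import Relation.Binary.PropositionalEquality using (_≡_)
open import Relation.Binary.Definitions using (DecidableEquality)
import Data.List.Properties as LP

data Letter : Set where
  x y : Letter

_≟L_ : DecidableEquality Letter
x ≟L x = Relation.Nullary.yes Relation.Binary.PropositionalEquality.refl
x ≟L y = Relation.Nullary.no λ ()
y ≟L x = Relation.Nullary.no λ ()
y ≟L y = Relation.Nullary.yes Relation.Binary.PropositionalEquality.refl

Word : Set
Word = List Letter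

_≟W_ : DecidableEquality Word
_≟W_ = LP.≡-dec _≟L_

-- Elements of 𝔥_t = ℚ[t]⟨A⟩, represented as finite formal sums of
-- monomials  q · t^n · w  (q ∈ ℚ, n ∈ ℕ, w ∈ A*).

Term : Set
Term = ℚ × ℕ × Word

Poly : Set
Poly = List Term

coeff : Poly → Word → ℕ → ℚ
coeff [] w m = 0ℚ
coeff ((q , n , u) ∷ P) w m =
  (if does (u ≟W w) ∧ does (n ℕ.≟ m) then q else 0ℚ) +ℚ coeff P w m

infix 4 _≈_
_≈_ : Poly → Poly → Set
P ≈ Q = ∀ w m → coeff P w m ≡ coeff Q w m

zeroP : Poly
zeroP = []

oneP : Poly
oneP = [ (1ℚ , 0 , []) ]

yP : Poly
yP = [ (1ℚ , 0 , [ y ]) ]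

infixl 6 _⊕_
_⊕_ : Poly → Poly → Poly
_⊕_ = _++_

scale : ℚ → ℕ → Poly → Poly
scale q n = map λ { (c , k , w) → (q *ℚ c , n + k , w) }

prefix : Word → Poly → Poly
prefix u = map λ { (c , k , w) → (c , k , u ++ w) }

bilin : (Word → Word → Poly) → Poly → Poly → Poly
bilin f P Q = concatMap (λ { (c , k , u) →
                concatMap (λ { (d , l , v) → scale (c *ℚ d) (k + l) (f u v) }) Q }) P

EndsInY : Word → Set
EndsInY w = ∃[ u ] (w ≡ u ++ [ y ])

H1Word : Word → Set
H1Word w = (w ≡ []) ⊎ EndsInY w

H0Word : Word → Set
H0Word [] = ⊤
H0Word (x ∷ w) = EndsInY w
H0Word (y ∷ w) = ⊥

InH1 : Poly → Set
InH1 P = ∀ w m → ¬ (coeff P w m ≡ 0ℚ) → H1Word w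

InH0 : Poly → Set
InH0 P = ∀ w m → ¬ (coeff P w m ≡ 0ℚ) → H0Word w

isEmpty : Word → Bool
isEmpty [] = true
isEmpty (_ ∷ _) = false

-- δ(w) ρ(a) v  with ρ(x) = 0, ρ(y) = t x
δρ : Word → Letter → Word → Poly
δρ [] y v = [ (1ℚ , 1 , x ∷ v) ]
δρ _  _ v = []

shW : Word → Word → Poly
shW [] w = [ (1ℚ , 0 , w) ]
shW (a ∷ w₁) [] = [ (1ℚ , 0 , a ∷ w₁) ]
shW (a ∷ w₁) (b ∷ w₂) =
  prefix [ a ] (shW w₁ (b ∷ w₂))
  ⊕ prefix [ b ] (shW (a ∷ w₁) w₂)
  ⊕ scale (- 1ℚ) 0 (δρ w₁ a (b ∷ w₂))
  ⊕ scale (- 1ℚ) 0 (δρ w₂ b (a ∷ w₁))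

_⧢_ : Poly → Poly → Poly
_⧢_ = bilin shW

-- a word of 𝔥^1 as z_{k₁+1} ⋯ z_{kₙ+1} is encoded by the list k₁ ∷ ⋯ ∷ kₙ
-- (z_k = x^{k-1} y); words not in 𝔥^1 give nothing
toZ : Word → Maybe (List ℕ)
toZ [] = just []
toZ (y ∷ w) = Maybe.map (0 ∷_) (toZ w)
toZ (x ∷ w) = toZ w >>= bump
  where
  bump : List ℕ → Maybe (List ℕ)
  bump [] = nothing
  bump (k ∷ ks) = just (suc k ∷ ks)

zw : ℕ → Word      -- zw k = z_{k+1} = x^k y
zw k = replicate k x ++ [ y ]

fromZ : List ℕ → Word
fromZ [] = []
fromZ (k ∷ ks) = zw k ++ fromZ ks

isNil : List ℕ → Bool
isNil [] = true
isNil (_ ∷ _) = false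

stZ : List ℕ → List ℕ → Poly
stZ [] b = [ (1ℚ , 0 , fromZ b) ]
stZ (k ∷ a) [] = [ (1ℚ , 0 , fromZ (k ∷ a)) ]
stZ (k ∷ a) (l ∷ b) =
  prefix (zw k) (stZ a (l ∷ b))
  ⊕ prefix (zw l) (stZ (k ∷ a) b)
  -- (1 - 2t) z_{k+l} (w₁ * w₂)
  ⊕ scale 1ℚ 0 (prefix (zw (suc (k + l))) (stZ a b))
  ⊕ scale (- (1ℚ +ℚ 1ℚ)) 1 (prefix (zw (suc (k + l))) (stZ a b))
  -- (1 - δ(w₁)δ(w₂)) (t² - t) x^{k+l} (w₁ * w₂)
  ⊕ (if isNil a ∧ isNil b then []
     else scale 1ℚ 2 (prefix (replicate (suc (suc (k + l))) x) (stZ a b))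
          ⊕ scale (- 1ℚ) 1 (prefix (replicate (suc (suc (k + l))) x) (stZ a b)))

stW : Word → Word → Poly
stW u v with toZ u | toZ v
... | just a | just b = stZ a b
... | _ | _ = []     -- outside 𝔥^1 (never used in the statement)

_⊛_ : Poly → Poly → Poly
_⊛_ = bilin stW

powY : (Poly → Poly → Poly) → ℕ → Poly
powY _⋆_ zero = oneP
powY _⋆_ (suc i) = yP ⋆ powY _⋆_ i

evalFrom : (Poly → Poly → Poly) → ℕ → List Poly → Poly
evalFrom _⋆_ j [] = zeroP
evalFrom _⋆_ j (Q ∷ Qs) = (Q ⋆ powY _⋆_ j) ⊕ evalFrom _⋆_ (suc j) Qs

evalY : (Poly → Poly → Poly) → List Poly → Poly
evalY _⋆_ = evalFrom _⋆_ 0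

-- i-th coefficient (0 beyond the length of the list)
nthP : List Poly → ℕ → Poly
nthP [] i = zeroP
nthP (Q ∷ Qs) zero = Q
nthP (Q ∷ Qs) (suc i) = nthP Qs i

H1IsPolyH0 : (Poly → Poly → Poly) → Set
H1IsPolyH0 _⋆_ =
  (∀ P → InH1 P → ∃[ Qs ] (All InH0 Qs × P ≈ evalY _⋆_ Qs))
  × (∀ Qs Rs → All InH0 Qs → All InH0 Rs →
       evalY _⋆_ Qs ≈ evalY _⋆_ Rs → ∀ i → nthP Qs i ≈ nthP Rs i)

{-# OPTIONS --safe #-}
module Submission where

-- Call the number of leading letters y of a word its depth, so that every word of 𝔥¹ is
-- uniquely y^d u with u ∈ 𝔥⁰ and d its depth. Both products are length-additive and
-- depth-subadditive on words, the only word of u ⋆ yⁿ (u ∈ 𝔥⁰) starting with yⁿ is yⁿu,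
-- with coefficient 1, and y ⋆ yⁿ contains yⁿ⁺¹ with coefficient n + 1. Hence
-- u ⋆ y^{⋆d} = d! y^d u + (terms of depth < d): writing an element as Σ Qᵢ ⋆ y^{⋆i} is a
-- triangular system with invertible diagonal, solvable by induction on depth and with a
-- unique solution.

open import Defs
open import Data.Bool using (true; false; if_then_else_; _∧_)
open import Data.Empty using (⊥-elim)
open import Data.List using (List; []; _∷_; _++_; [_]; map; concatMap; replicate; length; filter; initLast; _∷ʳ′_)
import Data.List.Properties as List
open import Data.List.Relation.Unary.All using (All; []; _∷_)
import Data.List.Relation.Unary.All as All
import Data.List.Relation.Unary.All.Properties as All
open import Data.Maybe using (just; nothing)
open import Data.Nat as ℕ using (ℕ; zero; suc; _+_; _∸_; _≤_; _<_; z≤n; s≤s)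
import Data.Nat.Properties as ℕ
open import Data.Nat.Tactic.RingSolver using (solve-∀)
open import Data.Product using (_×_; _,_; proj₁; proj₂; ∃-syntax)
open import Data.Rational as ℚ using (ℚ; 0ℚ; 1ℚ; -_; 1/_) renaming (_+_ to _+ℚ_; _*_ to _*ℚ_)
import Data.Rational.Properties as ℚ
open import Data.Rational.Solver using (module +-*-Solver)
open import Data.Sum using (_⊎_; inj₁; inj₂)
open import Function using (_∘_)
open import Relation.Nullary using (¬_; Dec; yes; no; does; ¬?; _×-dec_; _⊎-dec_)
open import Relation.Nullary.Decidable using (does-⇔; dec-true; dec-false)
open import Function.Bundles using (mk⇔)
open import Relation.Binary.Definitions using (tri<; tri≈; tri>)
open import Relation.Binary.PropositionalEquality
  using (_≡_; _≢_; refl; sym; trans; cong; cong₂; subst; subst₂; module ≡-Reasoning)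

natℚ : ℕ → ℚ
natℚ zero = 0ℚ
natℚ (suc n) = 1ℚ +ℚ natℚ n

factℚ : ℕ → ℚ
factℚ zero = 1ℚ
factℚ (suc n) = natℚ (suc n) *ℚ factℚ n

natℚ-nonNeg : ∀ n → ℚ.NonNegative (natℚ n)
natℚ-suc-pos : ∀ n → ℚ.Positive (natℚ (suc n))
natℚ-nonNeg zero = _
natℚ-nonNeg (suc n) = ℚ.pos⇒nonNeg (natℚ (suc n)) {{natℚ-suc-pos n}}
natℚ-suc-pos n = ℚ.pos+nonNeg⇒pos 1ℚ (natℚ n) {{natℚ-nonNeg n}}

factℚ-pos : ∀ n → ℚ.Positive (factℚ n)
factℚ-pos zero = _
factℚ-pos (suc n) = ℚ.pos*pos⇒pos (natℚ (suc n)) {{natℚ-suc-pos n}} (factℚ n) {{factℚ-pos n}}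

factℚ-nonZero : ∀ n → ℚ.NonZero (factℚ n)
factℚ-nonZero n = ℚ.pos⇒nonZero (factℚ n) {{factℚ-pos n}}

1/factℚ : ℕ → ℚ
1/factℚ n = 1/_ (factℚ n) {{factℚ-nonZero n}}

1/factℚ*factℚ : ∀ n → 1/factℚ n *ℚ factℚ n ≡ 1ℚ
1/factℚ*factℚ n = ℚ.*-inverseˡ (factℚ n) {{factℚ-nonZero n}}

*-cancelˡ-≡0 : ∀ q .{{_ : ℚ.NonZero q}} c → q *ℚ c ≡ 0ℚ → c ≡ 0ℚ
*-cancelˡ-≡0 q c qc≡0 = begin
  c                    ≡⟨ sym (ℚ.*-identityˡ c) ⟩
  1ℚ *ℚ c              ≡⟨ cong (_*ℚ c) (sym (ℚ.*-inverseˡ q)) ⟩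
  (1/ q *ℚ q) *ℚ c     ≡⟨ ℚ.*-assoc (1/ q) q c ⟩
  1/ q *ℚ (q *ℚ c)     ≡⟨ cong (1/ q *ℚ_) qc≡0 ⟩
  1/ q *ℚ 0ℚ           ≡⟨ ℚ.*-zeroʳ (1/ q) ⟩
  0ℚ                   ∎
  where open ≡-Reasoning

depth : Word → ℕ
depth [] = 0
depth (x ∷ w) = 0
depth (y ∷ w) = suc (depth w)

y^ : ℕ → Word
y^ n = replicate n y

stripY : Word → Word
stripY [] = []
stripY (x ∷ w) = x ∷ w
stripY (y ∷ w) = stripY w

y^depth++stripY : ∀ w → y^ (depth w) ++ stripY w ≡ w
y^depth++stripY [] = refl
y^depth++stripY (x ∷ w) = refl
y^depth++stripY (y ∷ w) = cong (y ∷_) (y^depth++stripY w)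

depth-stripY : ∀ w → depth (stripY w) ≡ 0
depth-stripY [] = refl
depth-stripY (x ∷ w) = refl
depth-stripY (y ∷ w) = depth-stripY w

depth-y^++ : ∀ n w → depth (y^ n ++ w) ≡ n + depth w
depth-y^++ zero w = refl
depth-y^++ (suc n) w = cong suc (depth-y^++ n w)

depth-y^ : ∀ n → depth (y^ n) ≡ n
depth-y^ zero = refl
depth-y^ (suc n) = cong suc (depth-y^ n)

depth≤length : ∀ w → depth w ≤ length w
depth≤length [] = z≤n
depth≤length (x ∷ w) = z≤n
depth≤length (y ∷ w) = s≤s (depth≤length w)

depth<length : ∀ w → w ≢ y^ (length w) → depth w < length w
depth<length [] w≢ = ⊥-elim (w≢ refl)
depth<length (x ∷ w) w≢ = s≤s z≤n
depth<length (y ∷ w) w≢ = s≤s (depth<length w (w≢ ∘ cong (y ∷_)))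

EndsInY-++ : ∀ u {w} → EndsInY w → EndsInY (u ++ w)
EndsInY-++ u {w} (v , refl) = u ++ v , sym (List.++-assoc u v [ y ])

¬EndsInY-[] : ¬ EndsInY []
¬EndsInY-[] ([] , ())
¬EndsInY-[] (_ ∷ _ , ())

EndsInY⇒H1-tail : ∀ a w → EndsInY (a ∷ w) → H1Word w
EndsInY⇒H1-tail a w ([] , refl) = inj₁ refl
EndsInY⇒H1-tail a w (_ ∷ u , refl) = inj₂ (u , refl)

H1-∷⇒EndsInY : ∀ {a w} → H1Word (a ∷ w) → EndsInY (a ∷ w)
H1-∷⇒EndsInY (inj₂ e) = e

H0⇒H1 : ∀ w → H0Word w → H1Word w
H0⇒H1 [] _ = inj₁ refl
H0⇒H1 (x ∷ w) e = inj₂ (EndsInY-++ [ x ] e)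

H0⇒depth≡0 : ∀ w → H0Word w → depth w ≡ 0
H0⇒depth≡0 [] _ = refl
H0⇒depth≡0 (x ∷ w) _ = refl

EndsInY-x∷ : ∀ {w} → EndsInY (x ∷ w) → EndsInY w
EndsInY-x∷ ([] , ())
EndsInY-x∷ (_ ∷ u , refl) = u , refl

stripY-H0 : ∀ w → H1Word w → H0Word (stripY w)
stripY-H0 [] _ = _
stripY-H0 (x ∷ w) h = EndsInY-x∷ (H1-∷⇒EndsInY h)
stripY-H0 (y ∷ w) h = stripY-H0 w (EndsInY⇒H1-tail y w (H1-∷⇒EndsInY h))

EndsInY? : ∀ w → Dec (EndsInY w)
EndsInY? w with initLast w
... | [] = no ¬EndsInY-[]
... | u ∷ʳ′ y = yes (u , refl)
... | u ∷ʳ′ x = no λ { (v , e) → x≢y (List.∷ʳ-injectiveʳ u v e) }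
  where
  x≢y : x ≢ y
  x≢y ()

H1Word? : ∀ w → Dec (H1Word w)
H1Word? w = (w ≟W []) ⊎-dec EndsInY? w

wordOf : Term → Word
wordOf (_ , _ , w) = w

AllWords : (Word → Set) → Poly → Set
AllWords p = All (p ∘ wordOf)

AllWords-map : ∀ {p q : Word → Set} → (∀ {w} → p w → q w) → ∀ {P} → AllWords p P → AllWords q P
AllWords-map h = All.map h

AllWords-++ : ∀ {p : Word → Set} {P R} → AllWords p P → AllWords p R → AllWords p (P ⊕ R)
AllWords-++ = All.++⁺

AllWords-scale : ∀ {p : Word → Set} q n {P} → AllWords p P → AllWords p (scale q n P)
AllWords-scale q n [] = []
AllWords-scale q n (pw ∷ ps) = pw ∷ AllWords-scale q n ps

AllWords-prefix : ∀ {p q : Word → Set} u → (∀ {w} → p w → q (u ++ w)) →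
                  ∀ {P} → AllWords p P → AllWords q (prefix u P)
AllWords-prefix u h [] = []
AllWords-prefix u h (pw ∷ ps) = h pw ∷ AllWords-prefix u h ps

AllWords-concatMap : ∀ {p q : Word → Set} (F : Term → Poly) →
                     (∀ {c k u} → q u → AllWords p (F (c , k , u))) →
                     ∀ {P} → AllWords q P → AllWords p (concatMap F P)
AllWords-concatMap F h [] = []
AllWords-concatMap F h (qu ∷ qs) = All.++⁺ (h qu) (AllWords-concatMap F h qs)

depthBound : Poly → ℕ
depthBound [] = 0
depthBound ((_ , _ , w) ∷ P) = suc (depth w) ℕ.⊔ depthBound P

depth<depthBound : ∀ P → AllWords (λ w → depth w < depthBound P) P
depth<depthBound [] = []
depth<depthBound ((_ , _ , w) ∷ P) =
  ℕ.m≤m⊔n (suc (depth w)) (depthBound P) ∷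
  AllWords-map (λ lt → ℕ.<-≤-trans lt (ℕ.m≤n⊔m (suc (depth w)) (depthBound P))) (depth<depthBound P)

monomial : ℚ → ℕ → Word → Poly
monomial c n u = [ (c , n , u) ]

-- The summand contributed by one term to a coefficient, so that
-- coeff (t ∷ P) w m is definitionally termCoeff t w m +ℚ coeff P w m.
termCoeff : Term → Word → ℕ → ℚ
termCoeff (c , n , u) w m = if does (u ≟W w) ∧ does (n ℕ.≟ m) then c else 0ℚ

termCoeff-≢ : ∀ c n u w m → ¬ (u ≡ w × n ≡ m) → termCoeff (c , n , u) w m ≡ 0ℚ
termCoeff-≢ c n u w m ne with u ≟W w
... | yes refl = cong (λ b → if b then c else 0ℚ) (dec-false (n ℕ.≟ m) λ n≡m → ne (refl , n≡m))
... | no _ = refl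

termCoeff-diag : ∀ c n w → termCoeff (c , n , w) w n ≡ c
termCoeff-diag c n w =
  cong (λ b → if b then c else 0ℚ) (cong₂ _∧_ (dec-true (w ≟W w) refl) (dec-true (n ℕ.≟ n) refl))

termCoeff-* : ∀ q c n u w m → termCoeff (q *ℚ c , n , u) w m ≡ q *ℚ termCoeff (c , n , u) w m
termCoeff-* q c n u w m with does (u ≟W w) ∧ does (n ℕ.≟ m)
... | true = refl
... | false = sym (ℚ.*-zeroʳ q)

termCoeff-1* : ∀ c n u w m → termCoeff (1ℚ *ℚ c , n , u) w m ≡ termCoeff (c , n , u) w m
termCoeff-1* c n u w m = trans (termCoeff-* 1ℚ c n u w m) (ℚ.*-identityˡ _)

termCoeff-prefix : ∀ c n p u w m → termCoeff (c , n , p ++ u) (p ++ w) m ≡ termCoeff (c , n , u) w m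
termCoeff-prefix c n p u w m =
  cong (λ b → if b ∧ does (n ℕ.≟ m) then c else 0ℚ)
       (does-⇔ (mk⇔ (List.++-cancelˡ p u w) (cong (p ++_))) ((p ++ u) ≟W (p ++ w)) (u ≟W w))

termCoeff-+ : ∀ c k n u w m → termCoeff (c , k + n , u) w (k + m) ≡ termCoeff (c , n , u) w m
termCoeff-+ c k n u w m =
  cong (λ b → if does (u ≟W w) ∧ b then c else 0ℚ)
       (does-⇔ (mk⇔ (ℕ.+-cancelˡ-≡ k n m) (cong (k +_))) (k + n ℕ.≟ k + m) (n ℕ.≟ m))

coeff-monomial : ∀ c n u w m → coeff (monomial c n u) w m ≡ termCoeff (c , n , u) w m
coeff-monomial c n u w m = ℚ.+-identityʳ _

δʷ : Word → Word → ℚ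
δʷ u w = if does (u ≟W w) then 1ℚ else 0ℚ

δᵉ : ℕ → ℕ → ℚ
δᵉ n m = if does (n ℕ.≟ m) then 1ℚ else 0ℚ

δᵉ-≢ : ∀ {n m} → n ≢ m → δᵉ n m ≡ 0ℚ
δᵉ-≢ {n} {m} n≢m = cong (λ b → if b then 1ℚ else 0ℚ) (dec-false (n ℕ.≟ m) n≢m)

δᵉ-+ : ∀ l j → δᵉ l (l + j) ≡ δᵉ 0 j
δᵉ-+ l j = cong (λ b → if b then 1ℚ else 0ℚ)
  (does-⇔ (mk⇔ (λ l≡l+j → ℕ.+-cancelˡ-≡ l 0 j (trans (ℕ.+-identityʳ l) l≡l+j))
               (λ 0≡j → trans (sym (ℕ.+-identityʳ l)) (cong (l +_) 0≡j)))
          (l ℕ.≟ l + j) (0 ℕ.≟ j))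

termCoeff-δ : ∀ c n u w m → termCoeff (c , n , u) w m ≡ c *ℚ (δʷ u w *ℚ δᵉ n m)
termCoeff-δ c n u w m = split (does (u ≟W w)) (does (n ℕ.≟ m))
  where
  split : ∀ a b → (if a ∧ b then c else 0ℚ) ≡ c *ℚ ((if a then 1ℚ else 0ℚ) *ℚ (if b then 1ℚ else 0ℚ))
  split true true = sym (ℚ.*-identityʳ c)
  split true false = sym (ℚ.*-zeroʳ c)
  split false true = sym (ℚ.*-zeroʳ c)
  split false false = sym (ℚ.*-zeroʳ c)

termCoeff-1-self : ∀ l w m → termCoeff (1ℚ , l , w) w m ≡ δᵉ l m
termCoeff-1-self l w m = cong (λ b → if b ∧ does (l ℕ.≟ m) then 1ℚ else 0ℚ) (dec-true (w ≟W w) refl)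

coeff-++ : ∀ P R w m → coeff (P ⊕ R) w m ≡ coeff P w m +ℚ coeff R w m
coeff-++ [] R w m = sym (ℚ.+-identityˡ _)
coeff-++ (t ∷ P) R w m =
  trans (cong (termCoeff t w m +ℚ_) (coeff-++ P R w m)) (sym (ℚ.+-assoc (termCoeff t w m) _ _))

coeff-⊕-nullʳ : ∀ P R w m → coeff R w m ≡ 0ℚ → coeff (P ⊕ R) w m ≡ coeff P w m
coeff-⊕-nullʳ P R w m R≡0 = trans (coeff-++ P R w m) (trans (cong (coeff P w m +ℚ_) R≡0) (ℚ.+-identityʳ _))

coeff-scale₀ : ∀ q P w m → coeff (scale q 0 P) w m ≡ q *ℚ coeff P w m
coeff-scale₀ q [] w m = sym (ℚ.*-zeroʳ q)
coeff-scale₀ q ((c , k , u) ∷ P) w m =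
  trans (cong₂ _+ℚ_ (termCoeff-* q c k u w m) (coeff-scale₀ q P w m)) (sym (ℚ.*-distribˡ-+ q _ _))

coeff-scale : ∀ q n P w m → coeff (scale q n P) w m ≡ q *ℚ coeff (scale 1ℚ n P) w m
coeff-scale q n [] w m = sym (ℚ.*-zeroʳ q)
coeff-scale q n ((c , k , u) ∷ P) w m =
  trans (cong₂ _+ℚ_ (trans (termCoeff-* q c (n + k) u w m)
                            (cong (q *ℚ_) (sym (termCoeff-1* c (n + k) u w m))))
                    (coeff-scale q n P w m))
        (sym (ℚ.*-distribˡ-+ q _ _))

coeff-scale-+ : ∀ n P w j → coeff (scale 1ℚ n P) w (n + j) ≡ coeff P w j
coeff-scale-+ n [] w j = refl
coeff-scale-+ n ((c , k , u) ∷ P) w j =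
  cong₂ _+ℚ_ (trans (termCoeff-+ (1ℚ *ℚ c) n k u w j) (termCoeff-1* c k u w j)) (coeff-scale-+ n P w j)

coeff-scale-< : ∀ q n P w m → m < n → coeff (scale q n P) w m ≡ 0ℚ
coeff-scale-< q n [] w m m<n = refl
coeff-scale-< q n ((c , k , u) ∷ P) w m m<n =
  trans (cong₂ _+ℚ_ (termCoeff-≢ (q *ℚ c) (n + k) u w m λ (_ , n+k≡m) →
                       ℕ.<⇒≱ m<n (subst (n ≤_) n+k≡m (ℕ.m≤m+n n k)))
                    (coeff-scale-< q n P w m m<n))
        (ℚ.+-identityʳ 0ℚ)

coeff-prefix : ∀ p P w m → coeff (prefix p P) (p ++ w) m ≡ coeff P w m
coeff-prefix p [] w m = refl
coeff-prefix p ((c , k , u) ∷ P) w m = cong₂ _+ℚ_ (termCoeff-prefix c k p u w m) (coeff-prefix p P w m)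

coeff-∉ : ∀ {p : Word → Set} P w m → AllWords p P → ¬ p w → coeff P w m ≡ 0ℚ
coeff-∉ [] w m _ _ = refl
coeff-∉ ((c , k , u) ∷ P) w m (pu ∷ ps) ¬pw =
  trans (cong₂ _+ℚ_ (termCoeff-≢ c k u w m λ (u≡w , _) → ¬pw (subst _ u≡w pu)) (coeff-∉ P w m ps ¬pw))
        (ℚ.+-identityʳ 0ℚ)

coeff-≢0⇒ : ∀ {p : Word → Set} P w m → AllWords p P → coeff P w m ≢ 0ℚ → p w
coeff-≢0⇒ [] w m _ nz = ⊥-elim (nz refl)
coeff-≢0⇒ ((c , k , u) ∷ P) w m (pu ∷ ps) nz with u ≟W w
... | yes refl = pu
... | no _ = coeff-≢0⇒ P w m ps (nz ∘ trans (ℚ.+-identityˡ _))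

coeff-depth> : ∀ P W m b → AllWords (λ w → depth w ≤ b) P → b < depth W → coeff P W m ≡ 0ℚ
coeff-depth> P W m b P≤b b<W = coeff-∉ P W m P≤b (ℕ.<⇒≱ b<W)

coeff-scale-δᵉ : ∀ R W c → (∀ j → coeff R W j ≡ c *ℚ δᵉ 0 j) →
                 ∀ l m → coeff (scale 1ℚ l R) W m ≡ c *ℚ δᵉ l m
coeff-scale-δᵉ R W c R≡cδ l m with m ℕ.<? l
... | yes m<l = trans (coeff-scale-< 1ℚ l R W m m<l)
                      (sym (trans (cong (c *ℚ_) (δᵉ-≢ λ l≡m → ℕ.<-irrefl (sym l≡m) m<l)) (ℚ.*-zeroʳ c)))
... | no m≮l = subst (λ m → coeff (scale 1ℚ l R) W m ≡ c *ℚ δᵉ l m) (ℕ.m+[n∸m]≡n (ℕ.≮⇒≥ m≮l)) (at (m ∸ l))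
  where
  at : ∀ j → coeff (scale 1ℚ l R) W (l + j) ≡ c *ℚ δᵉ l (l + j)
  at j = trans (coeff-scale-+ l R W j) (trans (R≡cδ j) (cong (c *ℚ_) (sym (δᵉ-+ l j))))

exponentOf : Term → ℕ
exponentOf (_ , k , _) = k

filterTerms : {r : ℕ → Word → Set} → (∀ k w → Dec (r k w)) → Poly → Poly
filterTerms r? = filter (λ t → r? (exponentOf t) (wordOf t))

coeff-filterTerms-∈ : ∀ {r : ℕ → Word → Set} (r? : ∀ k w → Dec (r k w)) P w m →
                      r m w → coeff (filterTerms r? P) w m ≡ coeff P w m
coeff-filterTerms-∈ r? [] w m _ = refl
coeff-filterTerms-∈ r? ((c , k , u) ∷ P) w m rmw with r? k u
... | yes _ = cong (termCoeff (c , k , u) w m +ℚ_) (coeff-filterTerms-∈ r? P w m rmw)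
... | no ¬rku = trans (coeff-filterTerms-∈ r? P w m rmw)
  (sym (trans (cong (_+ℚ coeff P w m) (termCoeff-≢ c k u w m λ { (refl , refl) → ¬rku rmw }))
              (ℚ.+-identityˡ _)))

coeff-filterTerms-∉ : ∀ {r : ℕ → Word → Set} (r? : ∀ k w → Dec (r k w)) P w m →
                      ¬ r m w → coeff (filterTerms r? P) w m ≡ 0ℚ
coeff-filterTerms-∉ r? [] w m _ = refl
coeff-filterTerms-∉ r? ((c , k , u) ∷ P) w m ¬rmw with r? k u
... | yes rku = trans (cong₂ _+ℚ_ (termCoeff-≢ c k u w m λ { (refl , refl) → ¬rmw rku })
                                  (coeff-filterTerms-∉ r? P w m ¬rmw))
                      (ℚ.+-identityʳ 0ℚ)
... | no _ = coeff-filterTerms-∉ r? P w m ¬rmw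

sumOver : (ℕ → Word → ℚ) → Poly → ℚ
sumOver g [] = 0ℚ
sumOver g ((d , l , v) ∷ P) = d *ℚ g l v +ℚ sumOver g P

sumOver-++ : ∀ g P R → sumOver g (P ⊕ R) ≡ sumOver g P +ℚ sumOver g R
sumOver-++ g [] R = sym (ℚ.+-identityˡ _)
sumOver-++ g ((d , l , v) ∷ P) R =
  trans (cong (d *ℚ g l v +ℚ_) (sumOver-++ g P R)) (sym (ℚ.+-assoc (d *ℚ g l v) _ _))

sumOver-scale₀ : ∀ g q P → sumOver g (scale q 0 P) ≡ q *ℚ sumOver g P
sumOver-scale₀ g q [] = sym (ℚ.*-zeroʳ q)
sumOver-scale₀ g q ((d , l , v) ∷ P) =
  trans (cong₂ _+ℚ_ (ℚ.*-assoc q d _) (sumOver-scale₀ g q P)) (sym (ℚ.*-distribˡ-+ q _ _))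

sumOver-*ˡ : ∀ c g P → sumOver (λ k u → c *ℚ g k u) P ≡ c *ℚ sumOver g P
sumOver-*ˡ c g [] = sym (ℚ.*-zeroʳ c)
sumOver-*ˡ c g ((d , l , v) ∷ P) =
  trans (cong₂ _+ℚ_ (*-swap d c (g l v)) (sumOver-*ˡ c g P)) (sym (ℚ.*-distribˡ-+ c _ _))
  where
  open +-*-Solver
  *-swap : ∀ a b e → a *ℚ (b *ℚ e) ≡ b *ℚ (a *ℚ e)
  *-swap = solve 3 (λ a b e → a :* (b :* e) := b :* (a :* e)) refl

sumOver-0 : ∀ P → sumOver (λ _ _ → 0ℚ) P ≡ 0ℚ
sumOver-0 [] = refl
sumOver-0 ((d , l , v) ∷ P) = trans (cong₂ _+ℚ_ (ℚ.*-zeroʳ d) (sumOver-0 P)) (ℚ.+-identityʳ 0ℚ)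

sumOver-termCoeff-scale : ∀ k P w m →
  sumOver (λ l v → termCoeff (1ℚ , k + l , v) w m) P ≡ coeff (scale 1ℚ k P) w m
sumOver-termCoeff-scale k [] w m = refl
sumOver-termCoeff-scale k ((d , l , v) ∷ P) w m =
  cong₂ _+ℚ_ (trans (sym (termCoeff-* d 1ℚ (k + l) v w m))
                    (cong (λ e → termCoeff (e , k + l , v) w m) (ℚ.*-comm d 1ℚ)))
             (sumOver-termCoeff-scale k P w m)

sumOver-termCoeff : ∀ P w m → sumOver (λ k u → termCoeff (1ℚ , k , u) w m) P ≡ coeff P w m
sumOver-termCoeff P w m =
  trans (sumOver-termCoeff-scale 0 P w m) (trans (coeff-scale₀ 1ℚ P w m) (ℚ.*-identityˡ _))

sumOver-cong : ∀ {p : Word → Set} g g' P → AllWords p P → (∀ k {u} → p u → g k u ≡ g' k u) →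
               sumOver g P ≡ sumOver g' P
sumOver-cong g g' [] [] h = refl
sumOver-cong g g' ((d , l , v) ∷ P) (pv ∷ ps) h =
  cong₂ _+ℚ_ (cong (d *ℚ_) (h l pv)) (sumOver-cong g g' P ps h)

removeTerm : ℕ → Word → Poly → Poly
removeTerm l v = filterTerms (λ k w → ¬? ((w ≟W v) ×-dec (k ℕ.≟ l)))

coeff-removeTerm : ∀ l v P k u →
                   coeff (removeTerm l v P) u k ≡ 0ℚ ⊎ coeff (removeTerm l v P) u k ≡ coeff P u k
coeff-removeTerm l v P k u with (u ≟W v) ×-dec (k ℕ.≟ l)
... | yes uk≡vl = inj₁ (coeff-filterTerms-∉ _ P u k λ ¬uk≡vl → ¬uk≡vl uk≡vl)
... | no uk≢vl = inj₂ (coeff-filterTerms-∈ _ P u k uk≢vl)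

removeTerm-∷-self : ∀ d l v P → removeTerm l v ((d , l , v) ∷ P) ≡ removeTerm l v P
removeTerm-∷-self d l v P =
  List.filter-reject (λ t → ¬? ((wordOf t ≟W v) ×-dec (exponentOf t ℕ.≟ l))) λ ¬vl≡vl → ¬vl≡vl (refl , refl)

removeTerm-∷-other : ∀ d k u l v P → ¬ (u ≡ v × k ≡ l) →
                     removeTerm l v ((d , k , u) ∷ P) ≡ (d , k , u) ∷ removeTerm l v P
removeTerm-∷-other d k u l v P = List.filter-accept (λ t → ¬? ((wordOf t ≟W v) ×-dec (exponentOf t ℕ.≟ l)))

sumOver-removeTerm : ∀ g l v P → sumOver g P ≡ coeff P v l *ℚ g l v +ℚ sumOver g (removeTerm l v P)
sumOver-removeTerm g l v [] = sym (trans (cong (_+ℚ 0ℚ) (ℚ.*-zeroˡ (g l v))) (ℚ.+-identityʳ 0ℚ))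
sumOver-removeTerm g l v ((d , k , u) ∷ P) with (u ≟W v) ×-dec (k ℕ.≟ l)
... | yes (refl , refl) rewrite removeTerm-∷-self d k u P = begin
    d *ℚ g k u +ℚ sumOver g P
      ≡⟨ cong (d *ℚ g k u +ℚ_) (sumOver-removeTerm g k u P) ⟩
    d *ℚ g k u +ℚ (coeff P u k *ℚ g k u +ℚ sumOver g R)
      ≡⟨ sym (ℚ.+-assoc (d *ℚ g k u) _ _) ⟩
    (d *ℚ g k u +ℚ coeff P u k *ℚ g k u) +ℚ sumOver g R
      ≡⟨ cong (_+ℚ sumOver g R) (sym (ℚ.*-distribʳ-+ (g k u) d (coeff P u k))) ⟩
    (d +ℚ coeff P u k) *ℚ g k u +ℚ sumOver g R
      ≡⟨ cong (λ e → (e +ℚ coeff P u k) *ℚ g k u +ℚ sumOver g R) (sym (termCoeff-diag d k u)) ⟩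
    coeff ((d , k , u) ∷ P) u k *ℚ g k u +ℚ sumOver g R ∎
  where
  open ≡-Reasoning
  R = removeTerm k u P
... | no uk≢vl rewrite removeTerm-∷-other d k u l v P uk≢vl = begin
    d *ℚ g k u +ℚ sumOver g P
      ≡⟨ cong (d *ℚ g k u +ℚ_) (sumOver-removeTerm g l v P) ⟩
    d *ℚ g k u +ℚ (coeff P v l *ℚ g l v +ℚ sumOver g R)
      ≡⟨ +-exchange (d *ℚ g k u) (coeff P v l) (g l v) (sumOver g R) ⟩
    (0ℚ +ℚ coeff P v l) *ℚ g l v +ℚ (d *ℚ g k u +ℚ sumOver g R)
      ≡⟨ cong (λ e → (e +ℚ coeff P v l) *ℚ g l v +ℚ (d *ℚ g k u +ℚ sumOver g R))
              (sym (termCoeff-≢ d k u v l uk≢vl)) ⟩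
    coeff ((d , k , u) ∷ P) v l *ℚ g l v +ℚ (d *ℚ g k u +ℚ sumOver g R) ∎
  where
  open ≡-Reasoning
  R = removeTerm l v P
  open +-*-Solver
  +-exchange : ∀ a b e f → a +ℚ (b *ℚ e +ℚ f) ≡ (0ℚ +ℚ b) *ℚ e +ℚ (a +ℚ f)
  +-exchange = solve 4 (λ a b e f → a :+ (b :* e :+ f) := (con 0ℚ :+ b) :* e :+ (a :+ f)) refl

length-removeTerm-∷ : ∀ d l v P → length (removeTerm l v ((d , l , v) ∷ P)) ≤ length P
length-removeTerm-∷ d l v P rewrite removeTerm-∷-self d l v P = List.length-filter _ P

-- Collect all terms with the head's monomial t^l v, then recurse on the shorter rest.
sumOver-cong-support : ∀ g g' P → (∀ k u → coeff P u k ≡ 0ℚ ⊎ g k u ≡ g' k u) →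
                       sumOver g P ≡ sumOver g' P
sumOver-cong-support g g' P = go (length P) P ℕ.≤-refl
  where
  go : ∀ n P → length P ≤ n → (∀ k u → coeff P u k ≡ 0ℚ ⊎ g k u ≡ g' k u) → sumOver g P ≡ sumOver g' P
  go _ [] _ _ = refl
  go (suc n) P@((d , l , v) ∷ P₀) (s≤s |P₀|≤n) h = begin
    sumOver g P                           ≡⟨ sumOver-removeTerm g l v P ⟩
    coeff P v l *ℚ g l v +ℚ sumOver g R    ≡⟨ cong₂ _+ℚ_ head (go n R |R|≤n h′) ⟩
    coeff P v l *ℚ g' l v +ℚ sumOver g' R  ≡⟨ sym (sumOver-removeTerm g' l v P) ⟩
    sumOver g' P                          ∎
    where
    open ≡-Reasoning
    R = removeTerm l v P
    |R|≤n : length R ≤ n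
    |R|≤n = ℕ.≤-trans (length-removeTerm-∷ d l v P₀) |P₀|≤n
    head : coeff P v l *ℚ g l v ≡ coeff P v l *ℚ g' l v
    head with h l v
    ... | inj₁ c≡0 rewrite c≡0 = trans (ℚ.*-zeroˡ (g l v)) (sym (ℚ.*-zeroˡ (g' l v)))
    ... | inj₂ g≡g' = cong (coeff P v l *ℚ_) g≡g'
    h′ : ∀ k u → coeff R u k ≡ 0ℚ ⊎ g k u ≡ g' k u
    h′ k u with coeff-removeTerm l v P k u | h k u
    ... | inj₁ c≡0 | _ = inj₁ c≡0
    ... | inj₂ c≡c | inj₁ c≡0 = inj₁ (trans c≡c c≡0)
    ... | inj₂ _ | inj₂ g≡g' = inj₂ g≡g'

coeff-concatMap : ∀ (F : Term → Poly) g P w m → (∀ c k u → coeff (F (c , k , u)) w m ≡ c *ℚ g k u) →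
                  coeff (concatMap F P) w m ≡ sumOver g P
coeff-concatMap F g [] w m h = refl
coeff-concatMap F g ((c , k , u) ∷ P) w m h =
  trans (coeff-++ (F (c , k , u)) (concatMap F P) w m) (cong₂ _+ℚ_ (h c k u) (coeff-concatMap F g P w m h))

module _ (f : Word → Word → Poly) where

  private
    coeff-scale-* : ∀ c d n R w m → coeff (scale (c *ℚ d) n R) w m ≡ d *ℚ (c *ℚ coeff (scale 1ℚ n R) w m)
    coeff-scale-* c d n R w m =
      trans (coeff-scale (c *ℚ d) n R w m)
            (trans (cong (_*ℚ coeff (scale 1ℚ n R) w m) (ℚ.*-comm c d)) (ℚ.*-assoc d c _))

  coeff-bilin-monomial : ∀ k u Q w m →
    coeff (bilin f (monomial 1ℚ k u) Q) w m ≡ sumOver (λ l v → coeff (scale 1ℚ (k + l) (f u v)) w m) Q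
  coeff-bilin-monomial k u Q w m =
    trans (coeff-++ (concatMap _ Q) [] w m)
    (trans (ℚ.+-identityʳ _)
    (trans (coeff-concatMap _ (λ l v → 1ℚ *ℚ coeff (scale 1ℚ (k + l) (f u v)) w m) Q w m
                            (λ d l v → coeff-scale-* 1ℚ d (k + l) (f u v) w m))
    (trans (sumOver-*ˡ 1ℚ _ Q) (ℚ.*-identityˡ _))))

  coeff-bilin : ∀ P Q w m →
    coeff (bilin f P Q) w m ≡ sumOver (λ k u → coeff (bilin f (monomial 1ℚ k u) Q) w m) P
  coeff-bilin P Q w m = coeff-concatMap _ _ P w m λ c k u →
    trans (coeff-concatMap _ (λ l v → c *ℚ coeff (scale 1ℚ (k + l) (f u v)) w m) Q w m
                           (λ d l v → coeff-scale-* c d (k + l) (f u v) w m))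
    (trans (sumOver-*ˡ c _ Q) (cong (c *ℚ_) (sym (coeff-bilin-monomial k u Q w m))))

  coeff-bilin-monomial-* : ∀ c k u Q w m →
    coeff (bilin f (monomial c k u) Q) w m ≡ c *ℚ coeff (bilin f (monomial 1ℚ k u) Q) w m
  coeff-bilin-monomial-* c k u Q w m = trans (coeff-bilin (monomial c k u) Q w m) (ℚ.+-identityʳ _)

  coeff-bilin-⊕ˡ : ∀ P R Q w m → coeff (bilin f (P ⊕ R) Q) w m ≡ coeff (bilin f P Q) w m +ℚ coeff (bilin f R Q) w m
  coeff-bilin-⊕ˡ P R Q w m =
    trans (coeff-bilin (P ⊕ R) Q w m)
    (trans (sumOver-++ _ P R) (sym (cong₂ _+ℚ_ (coeff-bilin P Q w m) (coeff-bilin R Q w m))))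

  coeff-bilin-scale₀ˡ : ∀ q P Q w m → coeff (bilin f (scale q 0 P) Q) w m ≡ q *ℚ coeff (bilin f P Q) w m
  coeff-bilin-scale₀ˡ q P Q w m =
    trans (coeff-bilin (scale q 0 P) Q w m)
    (trans (sumOver-scale₀ _ q P) (cong (q *ℚ_) (sym (coeff-bilin P Q w m))))

  coeff-bilin-nullˡ : ∀ P Q w m → (∀ u k → coeff P u k ≡ 0ℚ) → coeff (bilin f P Q) w m ≡ 0ℚ
  coeff-bilin-nullˡ P Q w m P≈0 =
    trans (coeff-bilin P Q w m)
    (trans (sumOver-cong-support _ (λ _ _ → 0ℚ) P (λ k u → inj₁ (P≈0 u k))) (sumOver-0 P))

  AllWords-bilin : ∀ {p q r : Word → Set} P Q → AllWords p P → AllWords q Q →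
                   (∀ {u v} → p u → q v → AllWords r (f u v)) → AllWords r (bilin f P Q)
  AllWords-bilin P Q pP qQ h =
    AllWords-concatMap _ (λ {c} {k} pu →
      AllWords-concatMap _ (λ {d} {l} qv → AllWords-scale (c *ℚ d) (k + l) (h pu qv)) qQ) pP

Supported : (Word → Set) → Poly → Set
Supported p P = ∀ w m → coeff P w m ≢ 0ℚ → p w

AllWords⇒Supported : ∀ {p : Word → Set} {P} → AllWords p P → Supported p P
AllWords⇒Supported {P = P} pP w m = coeff-≢0⇒ P w m pP

Supported-[] : ∀ {p : Word → Set} → Supported p []
Supported-[] w m nz = ⊥-elim (nz refl)

Supported-⊕ : ∀ {p : Word → Set} P R → Supported p P → Supported p R → Supported p (P ⊕ R)
Supported-⊕ P R sP sR w m nz with coeff P w m ℚ.≟ 0ℚ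
... | no P≢0 = sP w m P≢0
... | yes P≡0 = sR w m λ R≡0 →
  nz (trans (coeff-++ P R w m) (trans (cong₂ _+ℚ_ P≡0 R≡0) (ℚ.+-identityʳ 0ℚ)))

Supported-scale₀ : ∀ {p : Word → Set} q P → Supported p P → Supported p (scale q 0 P)
Supported-scale₀ q P sP w m nz = sP w m λ P≡0 →
  nz (trans (coeff-scale₀ q P w m) (trans (cong (q *ℚ_) P≡0) (ℚ.*-zeroʳ q)))

Supported-∉ : ∀ {p : Word → Set} P w m → Supported p P → ¬ p w → coeff P w m ≡ 0ℚ
Supported-∉ P w m sP ¬pw with coeff P w m ℚ.≟ 0ℚ
... | yes c≡0 = c≡0
... | no c≢0 = ⊥-elim (¬pw (sP w m c≢0))

sumOver-cong-Supported : ∀ {p : Word → Set} g g' P → Supported p P → (∀ k {u} → p u → g k u ≡ g' k u) →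
                         sumOver g P ≡ sumOver g' P
sumOver-cong-Supported g g' P sP h = sumOver-cong-support g g' P decide
  where
  decide : ∀ k u → coeff P u k ≡ 0ℚ ⊎ g k u ≡ g' k u
  decide k u with coeff P u k ℚ.≟ 0ℚ
  ... | yes c≡0 = inj₁ c≡0
  ... | no c≢0 = inj₂ (h k (sP u k c≢0))

addL : List Poly → List Poly → List Poly
addL [] Rs = Rs
addL (Q ∷ Qs) [] = Q ∷ Qs
addL (Q ∷ Qs) (R ∷ Rs) = (Q ⊕ R) ∷ addL Qs Rs

placeAt : ℕ → Poly → List Poly
placeAt zero Q = [ Q ]
placeAt (suc d) Q = [] ∷ placeAt d Q

coeff-nthP-addL : ∀ A B i w m → coeff (nthP (addL A B) i) w m ≡ coeff (nthP A i) w m +ℚ coeff (nthP B i) w m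
coeff-nthP-addL [] B i w m = sym (ℚ.+-identityˡ _)
coeff-nthP-addL (Q ∷ A) [] i w m = sym (ℚ.+-identityʳ _)
coeff-nthP-addL (Q ∷ A) (R ∷ B) zero w m = coeff-++ Q R w m
coeff-nthP-addL (Q ∷ A) (R ∷ B) (suc i) w m = coeff-nthP-addL A B i w m

nthP-map-scale₀ : ∀ q A i → nthP (map (scale q 0) A) i ≡ scale q 0 (nthP A i)
nthP-map-scale₀ q [] i = refl
nthP-map-scale₀ q (Q ∷ A) zero = refl
nthP-map-scale₀ q (Q ∷ A) (suc i) = nthP-map-scale₀ q A i

module _ {p : Word → Set} where

  All-Supported-addL : ∀ A B → All (Supported p) A → All (Supported p) B → All (Supported p) (addL A B)
  All-Supported-addL [] B [] sB = sB
  All-Supported-addL (Q ∷ A) [] sA [] = sA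
  All-Supported-addL (Q ∷ A) (R ∷ B) (sQ ∷ sA) (sR ∷ sB) =
    Supported-⊕ Q R sQ sR ∷ All-Supported-addL A B sA sB

  All-Supported-scale₀ : ∀ q A → All (Supported p) A → All (Supported p) (map (scale q 0) A)
  All-Supported-scale₀ q [] [] = []
  All-Supported-scale₀ q (Q ∷ A) (sQ ∷ sA) = Supported-scale₀ q Q sQ ∷ All-Supported-scale₀ q A sA

  All-Supported-placeAt : ∀ d {Q} → Supported p Q → All (Supported p) (placeAt d Q)
  All-Supported-placeAt zero sQ = sQ ∷ []
  All-Supported-placeAt (suc d) sQ = Supported-[] ∷ All-Supported-placeAt d sQ

module _ (f : Word → Word → Poly) where

  coeff-evalFrom-∷ : ∀ j Q Qs w m →
    coeff (evalFrom (bilin f) j (Q ∷ Qs)) w m ≡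
    coeff (bilin f Q (powY (bilin f) j)) w m +ℚ coeff (evalFrom (bilin f) (suc j) Qs) w m
  coeff-evalFrom-∷ j Q Qs w m = coeff-++ (bilin f Q (powY (bilin f) j)) _ w m

  coeff-evalFrom-addL : ∀ j A B w m →
    coeff (evalFrom (bilin f) j (addL A B)) w m ≡
    coeff (evalFrom (bilin f) j A) w m +ℚ coeff (evalFrom (bilin f) j B) w m
  coeff-evalFrom-addL j [] B w m = sym (ℚ.+-identityˡ _)
  coeff-evalFrom-addL j (Q ∷ A) [] w m = sym (ℚ.+-identityʳ _)
  coeff-evalFrom-addL j (Q ∷ A) (R ∷ B) w m = begin
    coeff (evalFrom (bilin f) j (addL (Q ∷ A) (R ∷ B))) w m
      ≡⟨ coeff-evalFrom-∷ j (Q ⊕ R) (addL A B) w m ⟩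
    coeff (bilin f (Q ⊕ R) yʲ) w m +ℚ coeff (evalFrom (bilin f) (suc j) (addL A B)) w m
      ≡⟨ cong₂ _+ℚ_ (coeff-bilin-⊕ˡ f Q R yʲ w m) (coeff-evalFrom-addL (suc j) A B w m) ⟩
    (coeff (bilin f Q yʲ) w m +ℚ coeff (bilin f R yʲ) w m) +ℚ
      (coeff (evalFrom (bilin f) (suc j) A) w m +ℚ coeff (evalFrom (bilin f) (suc j) B) w m)
      ≡⟨ +-medial (coeff (bilin f Q yʲ) w m) (coeff (bilin f R yʲ) w m)
                  (coeff (evalFrom (bilin f) (suc j) A) w m) (coeff (evalFrom (bilin f) (suc j) B) w m) ⟩
    (coeff (bilin f Q yʲ) w m +ℚ coeff (evalFrom (bilin f) (suc j) A) w m) +ℚ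
      (coeff (bilin f R yʲ) w m +ℚ coeff (evalFrom (bilin f) (suc j) B) w m)
      ≡⟨ sym (cong₂ _+ℚ_ (coeff-evalFrom-∷ j Q A w m) (coeff-evalFrom-∷ j R B w m)) ⟩
    coeff (evalFrom (bilin f) j (Q ∷ A)) w m +ℚ coeff (evalFrom (bilin f) j (R ∷ B)) w m ∎
    where
    open ≡-Reasoning
    open +-*-Solver
    yʲ = powY (bilin f) j
    +-medial : ∀ a b c d → (a +ℚ b) +ℚ (c +ℚ d) ≡ (a +ℚ c) +ℚ (b +ℚ d)
    +-medial = solve 4 (λ a b c d → (a :+ b) :+ (c :+ d) := (a :+ c) :+ (b :+ d)) refl

  coeff-evalFrom-scale₀ : ∀ j q A w m →
    coeff (evalFrom (bilin f) j (map (scale q 0) A)) w m ≡ q *ℚ coeff (evalFrom (bilin f) j A) w m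
  coeff-evalFrom-scale₀ j q [] w m = sym (ℚ.*-zeroʳ q)
  coeff-evalFrom-scale₀ j q (Q ∷ A) w m =
    trans (coeff-evalFrom-∷ j (scale q 0 Q) (map (scale q 0) A) w m)
    (trans (cong₂ _+ℚ_ (coeff-bilin-scale₀ˡ f q Q (powY (bilin f) j) w m) (coeff-evalFrom-scale₀ (suc j) q A w m))
    (trans (sym (ℚ.*-distribˡ-+ q _ _)) (cong (q *ℚ_) (sym (coeff-evalFrom-∷ j Q A w m)))))

  coeff-evalFrom-placeAt : ∀ d j Q w m →
    coeff (evalFrom (bilin f) j (placeAt d Q)) w m ≡ coeff (bilin f Q (powY (bilin f) (d + j))) w m
  coeff-evalFrom-placeAt zero j Q w m = trans (coeff-evalFrom-∷ j Q [] w m) (ℚ.+-identityʳ _)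
  coeff-evalFrom-placeAt (suc d) j Q w m =
    trans (coeff-evalFrom-placeAt d (suc j) Q w m)
          (cong (λ n → coeff (bilin f Q (powY (bilin f) n)) w m) (ℕ.+-suc d j))

-- Products that are triangular with respect to depth

record IsTriangular (f : Word → Word → Poly) : Set where
  field
    length-additive   : ∀ u v → AllWords (λ w → length w ≡ length u + length v) (f u v)
    depth-subadditive : ∀ u v → AllWords (λ w → depth w ≤ depth u + depth v) (f u v)
    H1-closed         : ∀ u v → H1Word u → H1Word v → AllWords H1Word (f u v)
    coeff-y^-leading  : ∀ u n u' m → H0Word u → coeff (f u (y^ n)) (y^ n ++ u') m ≡ δʷ u u' *ℚ δᵉ 0 m
    coeff-y-y^        : ∀ n m → coeff (f [ y ] (y^ n)) (y^ (suc n)) m ≡ natℚ (suc n) *ℚ δᵉ 0 m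

module Triangular {f : Word → Word → Poly} (T : IsTriangular f) where
  open IsTriangular T

  y^⋆ : ℕ → Poly
  y^⋆ = powY (bilin f)

  y^⋆-homogeneous : ∀ n → AllWords (λ w → length w ≡ n) (y^⋆ n)
  y^⋆-homogeneous zero = refl ∷ []
  y^⋆-homogeneous (suc n) = AllWords-bilin f {p = _≡ [ y ]} yP (y^⋆ n) (refl ∷ []) (y^⋆-homogeneous n)
    λ { {v = v} refl |v|≡n → AllWords-map (λ e → trans e (cong suc |v|≡n)) (length-additive [ y ] v) }

  y^⋆-H1 : ∀ n → AllWords H1Word (y^⋆ n)
  y^⋆-H1 zero = inj₁ refl ∷ []
  y^⋆-H1 (suc n) = AllWords-bilin f yP (y^⋆ n) (inj₂ ([] , refl) ∷ []) (y^⋆-H1 n) λ {u} {v} → H1-closed u v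

  depth<n : ∀ {v n} → length v ≡ n → v ≢ y^ n → depth v < n
  depth<n refl v≢yⁿ = depth<length _ v≢yⁿ

  coeff-y^⋆-y^ : ∀ n m → coeff (y^⋆ n) (y^ n) m ≡ factℚ n *ℚ δᵉ 0 m
  coeff-y^⋆-y^ zero m = trans (ℚ.+-identityʳ (δᵉ 0 m)) (sym (ℚ.*-identityˡ (δᵉ 0 m)))
  coeff-y^⋆-y^ (suc n) m = begin
    coeff (y^⋆ (suc n)) (y^ (suc n)) m
      ≡⟨ coeff-bilin-monomial f 0 [ y ] (y^⋆ n) (y^ (suc n)) m ⟩
    sumOver (λ l v → coeff (scale 1ℚ l (f [ y ] v)) (y^ (suc n)) m) (y^⋆ n)
      ≡⟨ sumOver-cong _ _ (y^⋆ n) (y^⋆-homogeneous n) per-term ⟩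
    sumOver (λ l v → K *ℚ termCoeff (1ℚ , l , v) (y^ n) m) (y^⋆ n)
      ≡⟨ sumOver-*ˡ K _ (y^⋆ n) ⟩
    K *ℚ sumOver (λ l v → termCoeff (1ℚ , l , v) (y^ n) m) (y^⋆ n)
      ≡⟨ cong (K *ℚ_) (trans (sumOver-termCoeff (y^⋆ n) (y^ n) m) (coeff-y^⋆-y^ n m)) ⟩
    K *ℚ (factℚ n *ℚ δᵉ 0 m)
      ≡⟨ sym (ℚ.*-assoc K (factℚ n) _) ⟩
    factℚ (suc n) *ℚ δᵉ 0 m ∎
    where
    open ≡-Reasoning
    K = natℚ (suc n)
    per-term : ∀ l {v} → length v ≡ n →
               coeff (scale 1ℚ l (f [ y ] v)) (y^ (suc n)) m ≡ K *ℚ termCoeff (1ℚ , l , v) (y^ n) m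
    per-term l {v} |v|≡n with v ≟W y^ n
    ... | yes refl = coeff-scale-δᵉ (f [ y ] (y^ n)) (y^ (suc n)) K (coeff-y-y^ n) l m
    ... | no v≢yⁿ =
      trans (coeff-depth> (scale 1ℚ l (f [ y ] v)) (y^ (suc n)) m (suc (depth v)) (AllWords-scale 1ℚ l (depth-subadditive [ y ] v))
                          (subst (suc (depth v) <_) (sym (depth-y^ (suc n))) (s≤s (depth<n |v|≡n v≢yⁿ))))
            (sym (ℚ.*-zeroʳ K))

  depth-bilin-y^⋆ : ∀ c k a n → depth a ≡ 0 → AllWords (λ w → depth w ≤ n) (bilin f (monomial c k a) (y^⋆ n))
  depth-bilin-y^⋆ c k a n da≡0 =
    AllWords-bilin f {p = λ u → depth u ≡ 0} (monomial c k a) (y^⋆ n) (da≡0 ∷ []) (y^⋆-homogeneous n)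
      λ {u} {v} du≡0 |v|≡n → AllWords-map (λ le → ℕ.≤-trans le (bound du≡0 |v|≡n)) (depth-subadditive u v)
    where
    bound : ∀ {u v} → depth u ≡ 0 → length v ≡ n → depth u + depth v ≤ n
    bound {u} {v} du≡0 refl rewrite du≡0 = depth≤length v

  coeff-leading : ∀ k a n u' m → H0Word a →
    coeff (bilin f (monomial 1ℚ k a) (y^⋆ n)) (y^ n ++ u') m ≡ factℚ n *ℚ termCoeff (1ℚ , k , a) u' m
  coeff-leading k a n u' m a∈H0 = begin
    coeff (bilin f (monomial 1ℚ k a) (y^⋆ n)) W m
      ≡⟨ coeff-bilin-monomial f k a (y^⋆ n) W m ⟩
    sumOver (λ l v → coeff (scale 1ℚ (k + l) (f a v)) W m) (y^⋆ n)
      ≡⟨ sumOver-cong _ _ (y^⋆ n) (y^⋆-homogeneous n) per-term ⟩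
    sumOver (λ l v → δʷ a u' *ℚ termCoeff (1ℚ , k + l , v) (y^ n) m) (y^⋆ n)
      ≡⟨ sumOver-*ˡ (δʷ a u') _ (y^⋆ n) ⟩
    δʷ a u' *ℚ sumOver (λ l v → termCoeff (1ℚ , k + l , v) (y^ n) m) (y^⋆ n)
      ≡⟨ cong (δʷ a u' *ℚ_) (sumOver-termCoeff-scale k (y^⋆ n) (y^ n) m) ⟩
    δʷ a u' *ℚ coeff (scale 1ℚ k (y^⋆ n)) (y^ n) m
      ≡⟨ cong (δʷ a u' *ℚ_) (coeff-scale-δᵉ (y^⋆ n) (y^ n) (factℚ n) (coeff-y^⋆-y^ n) k m) ⟩
    δʷ a u' *ℚ (factℚ n *ℚ δᵉ k m)
      ≡⟨ *-exchange (δʷ a u') (factℚ n) (δᵉ k m) ⟩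
    factℚ n *ℚ (1ℚ *ℚ (δʷ a u' *ℚ δᵉ k m))
      ≡⟨ cong (factℚ n *ℚ_) (sym (termCoeff-δ 1ℚ k a u' m)) ⟩
    factℚ n *ℚ termCoeff (1ℚ , k , a) u' m ∎
    where
    open ≡-Reasoning
    W = y^ n ++ u'
    open +-*-Solver
    *-exchange : ∀ a b c → a *ℚ (b *ℚ c) ≡ b *ℚ (1ℚ *ℚ (a *ℚ c))
    *-exchange = solve 3 (λ a b c → a :* (b :* c) := b :* (con 1ℚ :* (a :* c))) refl
    per-term : ∀ l {v} → length v ≡ n →
               coeff (scale 1ℚ (k + l) (f a v)) W m ≡ δʷ a u' *ℚ termCoeff (1ℚ , k + l , v) (y^ n) m
    per-term l {v} |v|≡n with v ≟W y^ n
    ... | yes refl = coeff-scale-δᵉ (f a (y^ n)) W (δʷ a u') (λ j → coeff-y^-leading a n u' j a∈H0) (k + l) m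
    ... | no v≢yⁿ =
      trans (coeff-depth> (scale 1ℚ (k + l) (f a v)) W m (depth a + depth v)
                          (AllWords-scale 1ℚ (k + l) (depth-subadditive a v)) deeper)
            (sym (ℚ.*-zeroʳ (δʷ a u')))
      where
      deeper : depth a + depth v < depth W
      deeper rewrite H0⇒depth≡0 a a∈H0 | depth-y^++ n u' =
        ℕ.<-≤-trans (depth<n |v|≡n v≢yⁿ) (ℕ.m≤m+n n (depth u'))

  coeff-bilin-y^⋆-deep : ∀ D n W m → Supported H0Word D → n < depth W → coeff (bilin f D (y^⋆ n)) W m ≡ 0ℚ
  coeff-bilin-y^⋆-deep D n W m sD n<dW =
    trans (coeff-bilin f D (y^⋆ n) W m)
    (trans (sumOver-cong-Supported _ (λ _ _ → 0ℚ) D sD λ k {a} a∈H0 →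
              coeff-depth> _ W m n (depth-bilin-y^⋆ 1ℚ k a n (H0⇒depth≡0 a a∈H0)) n<dW)
           (sumOver-0 D))

  coeff-bilin-y^⋆-y^ : ∀ D n u' m → Supported H0Word D →
                       coeff (bilin f D (y^⋆ n)) (y^ n ++ u') m ≡ factℚ n *ℚ coeff D u' m
  coeff-bilin-y^⋆-y^ D n u' m sD =
    trans (coeff-bilin f D (y^⋆ n) (y^ n ++ u') m)
    (trans (sumOver-cong-Supported _ (λ k a → factℚ n *ℚ termCoeff (1ℚ , k , a) u' m) D sD
                                   λ k {a} → coeff-leading k a n u' m)
    (trans (sumOver-*ˡ (factℚ n) _ D) (cong (factℚ n *ℚ_) (sumOver-termCoeff D u' m))))

  coeff-evalFrom-null : ∀ j Ds W m → (∀ i w k → coeff (nthP Ds i) w k ≡ 0ℚ) →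
                        coeff (evalFrom (bilin f) j Ds) W m ≡ 0ℚ
  coeff-evalFrom-null j [] W m _ = refl
  coeff-evalFrom-null j (D ∷ Ds) W m Ds≈0 =
    trans (coeff-evalFrom-∷ f j D Ds W m)
    (trans (cong₂ _+ℚ_ (coeff-bilin-nullˡ f D (y^⋆ j) W m (Ds≈0 0))
                       (coeff-evalFrom-null (suc j) Ds W m (Ds≈0 ∘ suc)))
           (ℚ.+-identityʳ 0ℚ))

  -- The head D ⋆ y^{⋆j} only has words of depth ≤ j, so the tail vanishes in depth > j and is
  -- null by induction; then at y^j a only the head is left, with coefficient j! times that of a in D.
  evalFrom-deep-null : ∀ j Ds → All (Supported H0Word) Ds →
    (∀ W m → j ≤ depth W → coeff (evalFrom (bilin f) j Ds) W m ≡ 0ℚ) → ∀ i w m → coeff (nthP Ds i) w m ≡ 0ℚ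
  evalFrom-deep-null j [] [] _ i w m = refl
  evalFrom-deep-null j (D ∷ Ds) (sD ∷ sDs) deep≈0 = λ { zero → D≈0 ; (suc i) → Ds≈0 i }
    where
    open ≡-Reasoning
    Ds≈0 : ∀ i w m → coeff (nthP Ds i) w m ≡ 0ℚ
    Ds≈0 = evalFrom-deep-null (suc j) Ds sDs λ W m j<dW → begin
      coeff (evalFrom (bilin f) (suc j) Ds) W m
        ≡⟨ sym (ℚ.+-identityˡ _) ⟩
      0ℚ +ℚ coeff (evalFrom (bilin f) (suc j) Ds) W m
        ≡⟨ cong (_+ℚ _) (sym (coeff-bilin-y^⋆-deep D j W m sD j<dW)) ⟩
      coeff (bilin f D (y^⋆ j)) W m +ℚ coeff (evalFrom (bilin f) (suc j) Ds) W m
        ≡⟨ sym (coeff-evalFrom-∷ f j D Ds W m) ⟩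
      coeff (evalFrom (bilin f) j (D ∷ Ds)) W m
        ≡⟨ deep≈0 W m (ℕ.<⇒≤ j<dW) ⟩
      0ℚ ∎
    D≈0 : ∀ a k → coeff D a k ≡ 0ℚ
    D≈0 a k = *-cancelˡ-≡0 (factℚ j) {{factℚ-nonZero j}} (coeff D a k) (begin
      factℚ j *ℚ coeff D a k
        ≡⟨ sym (coeff-bilin-y^⋆-y^ D j a k sD) ⟩
      coeff (bilin f D (y^⋆ j)) W k
        ≡⟨ sym (ℚ.+-identityʳ (coeff (bilin f D (y^⋆ j)) W k)) ⟩
      coeff (bilin f D (y^⋆ j)) W k +ℚ 0ℚ
        ≡⟨ cong (coeff (bilin f D (y^⋆ j)) W k +ℚ_) (sym (coeff-evalFrom-null (suc j) Ds W k Ds≈0)) ⟩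
      coeff (bilin f D (y^⋆ j)) W k +ℚ coeff (evalFrom (bilin f) (suc j) Ds) W k
        ≡⟨ sym (coeff-evalFrom-∷ f j D Ds W k) ⟩
      coeff (evalFrom (bilin f) j (D ∷ Ds)) W k
        ≡⟨ deep≈0 W k (subst (j ≤_) (sym (depth-y^++ j a)) (ℕ.m≤m+n j (depth a))) ⟩
      0ℚ ∎)
      where W = y^ j ++ a

  expansion-unique : ∀ Qs Rs → All InH0 Qs → All InH0 Rs →
                     evalY (bilin f) Qs ≈ evalY (bilin f) Rs → ∀ i → nthP Qs i ≈ nthP Rs i
  expansion-unique Qs Rs sQs sRs Qs≈Rs i w m = difference≡0⇒≡ (begin
    coeff (nthP Qs i) w m +ℚ (- 1ℚ) *ℚ coeff (nthP Rs i) w m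
      ≡⟨ cong (coeff (nthP Qs i) w m +ℚ_) (sym (trans (cong (λ R → coeff R w m) (nthP-map-scale₀ (- 1ℚ) Rs i))
                                                       (coeff-scale₀ (- 1ℚ) (nthP Rs i) w m))) ⟩
    coeff (nthP Qs i) w m +ℚ coeff (nthP −Rs i) w m
      ≡⟨ sym (coeff-nthP-addL Qs −Rs i w m) ⟩
    coeff (nthP (addL Qs −Rs) i) w m
      ≡⟨ evalFrom-deep-null 0 (addL Qs −Rs) (All-Supported-addL Qs −Rs sQs (All-Supported-scale₀ (- 1ℚ) Rs sRs))
                            difference-vanishes i w m ⟩
    0ℚ ∎)
    where
    open ≡-Reasoning
    −Rs = map (scale (- 1ℚ) 0) Rs
    difference-vanishes : ∀ W k → 0 ≤ depth W → coeff (evalY (bilin f) (addL Qs −Rs)) W k ≡ 0ℚ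
    difference-vanishes W k _ = begin
      coeff (evalY (bilin f) (addL Qs −Rs)) W k
        ≡⟨ coeff-evalFrom-addL f 0 Qs −Rs W k ⟩
      coeff (evalY (bilin f) Qs) W k +ℚ coeff (evalY (bilin f) −Rs) W k
        ≡⟨ cong₂ _+ℚ_ (Qs≈Rs W k) (coeff-evalFrom-scale₀ f 0 (- 1ℚ) Rs W k) ⟩
      coeff (evalY (bilin f) Rs) W k +ℚ (- 1ℚ) *ℚ coeff (evalY (bilin f) Rs) W k
        ≡⟨ x-x≡0 (coeff (evalY (bilin f) Rs) W k) ⟩
      0ℚ ∎
      where
      open +-*-Solver
      x-x≡0 : ∀ a → a +ℚ (- 1ℚ) *ℚ a ≡ 0ℚ
      x-x≡0 = solve 1 (λ a → a :+ con (- 1ℚ) :* a := con 0ℚ) refl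
    difference≡0⇒≡ : ∀ {a b} → a +ℚ (- 1ℚ) *ℚ b ≡ 0ℚ → a ≡ b
    difference≡0⇒≡ {a} {b} a-b≡0 = begin
      a                                 ≡⟨ a≡[a-b]+b a b ⟩
      (a +ℚ (- 1ℚ) *ℚ b) +ℚ b           ≡⟨ cong (_+ℚ b) a-b≡0 ⟩
      0ℚ +ℚ b                           ≡⟨ ℚ.+-identityˡ b ⟩
      b                                 ∎
      where
      open +-*-Solver
      a≡[a-b]+b : ∀ a b → a ≡ (a +ℚ (- 1ℚ) *ℚ b) +ℚ b
      a≡[a-b]+b = solve 2 (λ a b → a := (a :+ con (- 1ℚ) :* b) :+ b) refl

  lowerPart : ℕ → Poly → Poly
  lowerPart d = filterTerms (λ _ w → depth w ℕ.<? d)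

  leadingProduct : ℕ → Word → Poly
  leadingProduct k w = bilin f (monomial 1ℚ k (stripY w)) (y^⋆ (depth w))

  leadingProduct-H1 : ∀ k w → H1Word w → AllWords H1Word (leadingProduct k w)
  leadingProduct-H1 k w w∈H1 =
    AllWords-bilin f (monomial 1ℚ k (stripY w)) (y^⋆ (depth w)) (H0⇒H1 _ (stripY-H0 w w∈H1) ∷ [])
                   (y^⋆-H1 (depth w)) λ {u} {v} → H1-closed u v

  factℚ*termCoeff-depth≢ : ∀ k w W m → depth W ≢ depth w → factℚ (depth w) *ℚ termCoeff (1ℚ , k , w) W m ≡ 0ℚ
  factℚ*termCoeff-depth≢ k w W m dW≢dw =
    trans (cong (factℚ (depth w) *ℚ_) (termCoeff-≢ 1ℚ k w W m λ (w≡W , _) → dW≢dw (cong depth (sym w≡W))))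
          (ℚ.*-zeroʳ (factℚ (depth w)))

  coeff-leadingProduct-same-depth : ∀ k w → H1Word w → ∀ W m → depth W ≡ depth w →
    coeff (leadingProduct k w) W m ≡ factℚ (depth w) *ℚ termCoeff (1ℚ , k , w) W m
  coeff-leadingProduct-same-depth k w w∈H1 W m dW≡d =
    subst₂ (λ V w′ → coeff (leadingProduct k w) V m ≡ factℚ d *ℚ termCoeff (1ℚ , k , w′) V m)
           y^d++U≡W (y^depth++stripY w)
           (trans (coeff-leading k (stripY w) d U m (stripY-H0 w w∈H1))
                  (cong (factℚ d *ℚ_) (sym (termCoeff-prefix 1ℚ k (y^ d) (stripY w) U m))))
    where
    d = depth w
    U = stripY W
    y^d++U≡W : y^ d ++ U ≡ W
    y^d++U≡W = trans (cong (λ n → y^ n ++ U) (sym dW≡d)) (y^depth++stripY W)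

  leadingProduct-split : ∀ k w → H1Word w → ∀ W m →
    coeff (leadingProduct k w) W m ≡
    factℚ (depth w) *ℚ termCoeff (1ℚ , k , w) W m +ℚ coeff (lowerPart (depth w) (leadingProduct k w)) W m
  leadingProduct-split k w w∈H1 W m with ℕ.<-cmp (depth W) (depth w)
  ... | tri< dW<d dW≢d _ =
    trans (sym (coeff-filterTerms-∈ _ X W m dW<d))
          (sym (trans (cong (_+ℚ coeff (lowerPart d X) W m) (factℚ*termCoeff-depth≢ k w W m dW≢d))
                      (ℚ.+-identityˡ _)))
    where
    d = depth w
    X = leadingProduct k w
  ... | tri≈ _ dW≡d _ =
    trans (coeff-leadingProduct-same-depth k w w∈H1 W m dW≡d)
          (sym (trans (cong (factℚ (depth w) *ℚ termCoeff (1ℚ , k , w) W m +ℚ_)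
                            (coeff-filterTerms-∉ _ X W m λ dW<d → ℕ.<-irrefl dW≡d dW<d))
                      (ℚ.+-identityʳ _)))
    where X = leadingProduct k w
  ... | tri> _ dW≢d d<dW =
    trans (coeff-depth> X W m d (depth-bilin-y^⋆ 1ℚ k (stripY w) d (depth-stripY w)) d<dW)
          (sym (trans (cong₂ _+ℚ_ (factℚ*termCoeff-depth≢ k w W m dW≢d)
                                  (coeff-filterTerms-∉ _ X W m (ℕ.<-asym d<dW)))
                      (ℚ.+-identityʳ 0ℚ)))
    where
    d = depth w
    X = leadingProduct k w

  lowerPart-H1 : ∀ k w n → H1Word w → depth w ≤ n →
                 AllWords (λ v → H1Word v × depth v < n) (lowerPart (depth w) (leadingProduct k w))
  lowerPart-H1 k w n w∈H1 d≤n =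
    All.map (λ (v∈H1 , dv<d) → v∈H1 , ℕ.<-≤-trans dv<d d≤n)
            (All.zip (All.filter⁺ _ (leadingProduct-H1 k w w∈H1) , All.all-filter _ (leadingProduct k w)))

  -- The coefficient list of c t^k w: the leading coefficient c/d! (t^k u) at
  -- position d, corrected by the expansion of the lower part; the fuel n bounds the depth.
  mutual
    expandTerm : ℕ → Term → List Poly
    expandTerm zero _ = []
    expandTerm (suc n) (c , k , w) =
      addL (placeAt (depth w) (monomial (c *ℚ 1/factℚ (depth w)) k (stripY w)))
           (map (scale (- (c *ℚ 1/factℚ (depth w))) 0) (expand n (lowerPart (depth w) (leadingProduct k w))))

    expand : ℕ → Poly → List Poly
    expand n [] = []
    expand n (t ∷ P) = addL (expandTerm n t) (expand n P)

  mutual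
    expandTerm-correct : ∀ n c k w → H1Word w → depth w < n → ∀ W m →
      coeff (evalY (bilin f) (expandTerm n (c , k , w))) W m ≡ termCoeff (c , k , w) W m
    expandTerm-correct (suc n) c k w w∈H1 (s≤s d≤n) W m = begin
      coeff (evalY (bilin f) (addL Lead Lower)) W m
        ≡⟨ coeff-evalFrom-addL f 0 Lead Lower W m ⟩
      coeff (evalY (bilin f) Lead) W m +ℚ coeff (evalY (bilin f) Lower) W m
        ≡⟨ cong₂ _+ℚ_ (coeff-evalFrom-placeAt f d 0 M W m) (coeff-evalFrom-scale₀ f 0 (- c′) (expand n R) W m) ⟩
      coeff (bilin f M (y^⋆ (d + 0))) W m +ℚ (- c′) *ℚ coeff (evalY (bilin f) (expand n R)) W m
        ≡⟨ cong₂ _+ℚ_ (trans (cong (λ e → coeff (bilin f M (y^⋆ e)) W m) (ℕ.+-identityʳ d))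
                             (coeff-bilin-monomial-* f c′ k (stripY w) (y^⋆ d) W m))
                      (cong ((- c′) *ℚ_) (expand-correct n R (lowerPart-H1 k w n w∈H1 d≤n) W m)) ⟩
      c′ *ℚ coeff X W m +ℚ (- c′) *ℚ coeff R W m
        ≡⟨ cong (λ e → c′ *ℚ e +ℚ (- c′) *ℚ coeff R W m) (leadingProduct-split k w w∈H1 W m) ⟩
      c′ *ℚ (factℚ d *ℚ t +ℚ coeff R W m) +ℚ (- c′) *ℚ coeff R W m
        ≡⟨ lower-cancels c′ (factℚ d) t (coeff R W m) ⟩
      (c′ *ℚ factℚ d) *ℚ t
        ≡⟨ cong (_*ℚ t) c′d!≡c ⟩
      c *ℚ t
        ≡⟨ sym (termCoeff-* c 1ℚ k w W m) ⟩
      termCoeff (c *ℚ 1ℚ , k , w) W m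
        ≡⟨ cong (λ e → termCoeff (e , k , w) W m) (ℚ.*-identityʳ c) ⟩
      termCoeff (c , k , w) W m ∎
      where
      open ≡-Reasoning
      d = depth w
      c′ = c *ℚ 1/factℚ d
      M = monomial c′ k (stripY w)
      X = leadingProduct k w
      R = lowerPart d X
      Lead = placeAt d M
      Lower = map (scale (- c′) 0) (expand n R)
      t = termCoeff (1ℚ , k , w) W m
      c′d!≡c : c′ *ℚ factℚ d ≡ c
      c′d!≡c = trans (ℚ.*-assoc c _ _) (trans (cong (c *ℚ_) (1/factℚ*factℚ d)) (ℚ.*-identityʳ c))
      open +-*-Solver
      lower-cancels : ∀ a b t r → a *ℚ (b *ℚ t +ℚ r) +ℚ (- a) *ℚ r ≡ (a *ℚ b) *ℚ t
      lower-cancels = solve 4 (λ a b t r → a :* (b :* t :+ r) :+ (:- a) :* r := (a :* b) :* t) refl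

    expand-correct : ∀ n P → AllWords (λ w → H1Word w × depth w < n) P → ∀ W m →
      coeff (evalY (bilin f) (expand n P)) W m ≡ coeff P W m
    expand-correct n [] [] W m = refl
    expand-correct n ((c , k , w) ∷ P) ((w∈H1 , d<n) ∷ P-ok) W m =
      trans (coeff-evalFrom-addL f 0 (expandTerm n (c , k , w)) (expand n P) W m)
            (cong₂ _+ℚ_ (expandTerm-correct n c k w w∈H1 d<n W m) (expand-correct n P P-ok W m))

  mutual
    expandTerm-H0 : ∀ n c k w → H1Word w → All InH0 (expandTerm n (c , k , w))
    expandTerm-H0 zero c k w w∈H1 = []
    expandTerm-H0 (suc n) c k w w∈H1 =
      All-Supported-addL (placeAt d M) (map (scale (- c′) 0) (expand n R))
        (All-Supported-placeAt d (AllWords⇒Supported {P = M} (stripY-H0 w w∈H1 ∷ [])))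
        (All-Supported-scale₀ (- c′) (expand n R) (expand-H0 n R (All.filter⁺ _ (leadingProduct-H1 k w w∈H1))))
      where
      d = depth w
      c′ = c *ℚ 1/factℚ d
      M = monomial c′ k (stripY w)
      R = lowerPart d (leadingProduct k w)

    expand-H0 : ∀ n P → AllWords H1Word P → All InH0 (expand n P)
    expand-H0 n [] [] = []
    expand-H0 n ((c , k , w) ∷ P) (w∈H1 ∷ P-H1) =
      All-Supported-addL _ _ (expandTerm-H0 n c k w w∈H1) (expand-H0 n P P-H1)

  expansion-exists : ∀ P → InH1 P → ∃[ Qs ] (All InH0 Qs × P ≈ evalY (bilin f) Qs)
  expansion-exists P P∈H1 =
    expand n P′ , expand-H0 n P′ P′-H1 ,
    λ W m → sym (trans (expand-correct n P′ (All.zip (P′-H1 , depth<depthBound P′)) W m) (P′≈P W m))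
    where
    P′ = filterTerms (λ _ w → H1Word? w) P
    n = depthBound P′
    P′-H1 : AllWords H1Word P′
    P′-H1 = All.all-filter _ P
    P′≈P : ∀ W m → coeff P′ W m ≡ coeff P W m
    P′≈P W m with H1Word? W
    ... | yes W∈H1 = coeff-filterTerms-∈ _ P W m W∈H1
    ... | no W∉H1 = trans (coeff-filterTerms-∉ _ P W m W∉H1) (sym (Supported-∉ P W m P∈H1 W∉H1))

  H1-polynomial-in-y : H1IsPolyH0 (bilin f)
  H1-polynomial-in-y = expansion-exists , expansion-unique

-- The t-shuffle product is triangular

StartsWithX : Word → Set
StartsWithX w = ∃[ v ] (w ≡ x ∷ v)

coeff-StartsWithX-y∷ : ∀ P w m → AllWords StartsWithX P → coeff P (y ∷ w) m ≡ 0ℚ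
coeff-StartsWithX-y∷ P w m P-x = coeff-∉ P (y ∷ w) m P-x λ ()

AllWords-prefix-x∷ : ∀ u P → AllWords StartsWithX (prefix (x ∷ u) P)
AllWords-prefix-x∷ u [] = []
AllWords-prefix-x∷ u ((c , k , w) ∷ P) = (u ++ w , refl) ∷ AllWords-prefix-x∷ u P

AllWords-δρ : ∀ w a v → AllWords StartsWithX (δρ w a v)
AllWords-δρ [] x v = []
AllWords-δρ [] y v = (v , refl) ∷ []
AllWords-δρ (_ ∷ _) a v = []

coeff-monomial-1 : ∀ n u w m → coeff (monomial 1ℚ n u) w m ≡ δʷ u w *ℚ δᵉ n m
coeff-monomial-1 n u w m = trans (coeff-monomial 1ℚ n u w m) (trans (termCoeff-δ 1ℚ n u w m) (ℚ.*-identityˡ _))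

coeff-monomial-y^ : ∀ n u' m → coeff (monomial 1ℚ 0 (y^ n)) (y^ n ++ u') m ≡ δʷ [] u' *ℚ δᵉ 0 m
coeff-monomial-y^ n u' m =
  trans (cong (λ v → coeff (monomial 1ℚ 0 v) (y^ n ++ u') m) (sym (List.++-identityʳ (y^ n))))
        (trans (coeff-prefix (y^ n) (monomial 1ℚ 0 []) u' m) (coeff-monomial-1 0 [] u' m))

AllWords-shW : (P : Word → Word → Word → Set) →
  (∀ v → P [] v v) →
  (∀ a w₁ → P (a ∷ w₁) [] (a ∷ w₁)) →
  (∀ a w₁ b w₂ {w} → P w₁ (b ∷ w₂) w → P (a ∷ w₁) (b ∷ w₂) (a ∷ w)) →
  (∀ a w₁ b w₂ {w} → P (a ∷ w₁) w₂ w → P (a ∷ w₁) (b ∷ w₂) (b ∷ w)) →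
  (∀ b w₂ → P [ y ] (b ∷ w₂) (x ∷ b ∷ w₂)) →
  (∀ a w₁ → P (a ∷ w₁) [ y ] (x ∷ a ∷ w₁)) →
  ∀ u v → AllWords (P u v) (shW u v)
AllWords-shW P nilˡ nilʳ consˡ consʳ ρˡ ρʳ = go
  where
  δρˡ : ∀ a w₁ b w₂ → AllWords (P (a ∷ w₁) (b ∷ w₂)) (δρ w₁ a (b ∷ w₂))
  δρˡ x [] b w₂ = []
  δρˡ y [] b w₂ = ρˡ b w₂ ∷ []
  δρˡ a (_ ∷ _) b w₂ = []
  δρʳ : ∀ a w₁ b w₂ → AllWords (P (a ∷ w₁) (b ∷ w₂)) (δρ w₂ b (a ∷ w₁))
  δρʳ a w₁ x [] = []
  δρʳ a w₁ y [] = ρʳ a w₁ ∷ []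
  δρʳ a w₁ b (_ ∷ _) = []
  go : ∀ u v → AllWords (P u v) (shW u v)
  go [] v = nilˡ v ∷ []
  go (a ∷ w₁) [] = nilʳ a w₁ ∷ []
  go (a ∷ w₁) (b ∷ w₂) =
    AllWords-++ (AllWords-++ (AllWords-++ (AllWords-prefix [ a ] (consˡ a w₁ b w₂) (go w₁ (b ∷ w₂)))
                                           (AllWords-prefix [ b ] (consʳ a w₁ b w₂) (go (a ∷ w₁) w₂)))
                             (AllWords-scale (- 1ℚ) 0 (δρˡ a w₁ b w₂)))
                (AllWords-scale (- 1ℚ) 0 (δρʳ a w₁ b w₂))

shW-length-additive : ∀ u v → AllWords (λ w → length w ≡ length u + length v) (shW u v)
shW-length-additive = AllWords-shW _
  (λ v → refl)
  (λ a w₁ → sym (ℕ.+-identityʳ _))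
  (λ a w₁ b w₂ → cong suc)
  (λ a w₁ b w₂ e → trans (cong suc e) (sym (ℕ.+-suc (length (a ∷ w₁)) (length w₂))))
  (λ b w₂ → refl)
  (λ a w₁ → ℕ.+-comm 1 (length (a ∷ w₁)))

shW-depth-subadditive : ∀ u v → AllWords (λ w → depth w ≤ depth u + depth v) (shW u v)
shW-depth-subadditive = AllWords-shW _
  (λ v → ℕ.≤-refl)
  (λ a w₁ → ℕ.≤-reflexive (sym (ℕ.+-identityʳ (depth (a ∷ w₁)))))
  consˡ consʳ (λ _ _ → z≤n) (λ _ _ → z≤n)
  where
  consˡ : ∀ a w₁ b w₂ {w} → depth w ≤ depth w₁ + depth (b ∷ w₂) → depth (a ∷ w) ≤ depth (a ∷ w₁) + depth (b ∷ w₂)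
  consˡ x w₁ b w₂ _ = z≤n
  consˡ y w₁ b w₂ le = s≤s le
  consʳ : ∀ a w₁ b w₂ {w} → depth w ≤ depth (a ∷ w₁) + depth w₂ → depth (b ∷ w) ≤ depth (a ∷ w₁) + depth (b ∷ w₂)
  consʳ a w₁ x w₂ _ = z≤n
  consʳ a w₁ y w₂ {w} le = subst (suc (depth w) ≤_) (sym (ℕ.+-suc (depth (a ∷ w₁)) (depth w₂))) (s≤s le)

shW-H1-closed : ∀ u v → H1Word u → H1Word v → AllWords H1Word (shW u v)
shW-H1-closed [] v _ v∈H1 = v∈H1 ∷ []
shW-H1-closed u@(_ ∷ _) v u∈H1 v∈H1 =
  AllWords-map (λ ends → inj₂ (ends (inj₁ (H1-∷⇒EndsInY u∈H1)) u∈H1 v∈H1)) (AllWords-shW EndsInYShW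
    (λ { v (inj₁ []-ends) _ _ → ⊥-elim (¬EndsInY-[] []-ends) ; v (inj₂ e) _ _ → e })
    (λ { a w₁ (inj₁ e) _ _ → e ; a w₁ (inj₂ []-ends) _ _ → ⊥-elim (¬EndsInY-[] []-ends) })
    (λ a w₁ b w₂ ih _ u∈H1 v∈H1 →
       EndsInY-++ [ a ] (ih (inj₂ (H1-∷⇒EndsInY v∈H1)) (EndsInY⇒H1-tail a w₁ (H1-∷⇒EndsInY u∈H1)) v∈H1))
    (λ a w₁ b w₂ ih _ u∈H1 v∈H1 →
       EndsInY-++ [ b ] (ih (inj₁ (H1-∷⇒EndsInY u∈H1)) u∈H1 (EndsInY⇒H1-tail b w₂ (H1-∷⇒EndsInY v∈H1))))
    (λ b w₂ _ _ v∈H1 → EndsInY-++ [ x ] (H1-∷⇒EndsInY v∈H1))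
    (λ a w₁ _ u∈H1 _ → EndsInY-++ [ x ] (H1-∷⇒EndsInY u∈H1))
    u v)
  where
  EndsInYShW : Word → Word → Word → Set
  EndsInYShW u v w = EndsInY u ⊎ EndsInY v → H1Word u → H1Word v → EndsInY w

coeff-shW-at-y∷ : ∀ a w₁ w₂ w m →
  coeff (shW (a ∷ w₁) (y ∷ w₂)) (y ∷ w) m ≡
  coeff (prefix [ a ] (shW w₁ (y ∷ w₂))) (y ∷ w) m +ℚ coeff (shW (a ∷ w₁) w₂) w m
coeff-shW-at-y∷ a w₁ w₂ w m =
  trans (coeff-⊕-nullʳ ((A ⊕ B) ⊕ C) D (y ∷ w) m (vanishes w₂ y (a ∷ w₁)))
  (trans (coeff-⊕-nullʳ (A ⊕ B) C (y ∷ w) m (vanishes w₁ a (y ∷ w₂)))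
  (trans (coeff-++ A B (y ∷ w) m) (cong (coeff A (y ∷ w) m +ℚ_) (coeff-prefix [ y ] (shW (a ∷ w₁) w₂) w m))))
  where
  A = prefix [ a ] (shW w₁ (y ∷ w₂))
  B = prefix [ y ] (shW (a ∷ w₁) w₂)
  C = scale (- 1ℚ) 0 (δρ w₁ a (y ∷ w₂))
  D = scale (- 1ℚ) 0 (δρ w₂ y (a ∷ w₁))
  vanishes : ∀ w′ a′ v → coeff (scale (- 1ℚ) 0 (δρ w′ a′ v)) (y ∷ w) m ≡ 0ℚ
  vanishes w′ a′ v = coeff-StartsWithX-y∷ _ w m (AllWords-scale (- 1ℚ) 0 (AllWords-δρ w′ a′ v))

coeff-shW-y^-leading : ∀ u n u' m → depth u ≡ 0 → coeff (shW u (y^ n)) (y^ n ++ u') m ≡ δʷ u u' *ℚ δᵉ 0 m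
coeff-shW-y^-leading [] n u' m _ = coeff-monomial-y^ n u' m
coeff-shW-y^-leading (x ∷ w₁) zero u' m _ = coeff-monomial-1 0 (x ∷ w₁) u' m
coeff-shW-y^-leading (x ∷ w₁) (suc n) u' m d≡0 =
  trans (coeff-shW-at-y∷ x w₁ (y^ n) (y^ n ++ u') m)
  (trans (cong (_+ℚ coeff (shW (x ∷ w₁) (y^ n)) (y^ n ++ u') m)
               (coeff-StartsWithX-y∷ (prefix [ x ] (shW w₁ (y^ (suc n)))) _ m
                                     (AllWords-prefix-x∷ [] (shW w₁ (y^ (suc n))))))
  (trans (ℚ.+-identityˡ _) (coeff-shW-y^-leading (x ∷ w₁) n u' m d≡0)))

coeff-shW-y-y^ : ∀ n m → coeff (shW [ y ] (y^ n)) (y^ (suc n)) m ≡ natℚ (suc n) *ℚ δᵉ 0 m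
coeff-shW-y-y^ zero m =
  trans (coeff-monomial 1ℚ 0 [ y ] [ y ] m) (trans (termCoeff-1-self 0 [ y ] m) (sym (ℚ.*-identityˡ (δᵉ 0 m))))
coeff-shW-y-y^ (suc n) m = begin
  coeff (shW [ y ] (y^ (suc n))) (y ∷ y^ (suc n)) m
    ≡⟨ coeff-shW-at-y∷ y [] (y^ n) (y^ (suc n)) m ⟩
  coeff (prefix [ y ] (shW [] (y^ (suc n)))) (y ∷ y^ (suc n)) m +ℚ coeff (shW [ y ] (y^ n)) (y^ (suc n)) m
    ≡⟨ cong₂ _+ℚ_ (trans (coeff-prefix [ y ] (shW [] (y^ (suc n))) (y^ (suc n)) m)
                         (trans (coeff-monomial 1ℚ 0 (y^ (suc n)) (y^ (suc n)) m) (termCoeff-1-self 0 (y^ (suc n)) m)))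
                  (coeff-shW-y-y^ n m) ⟩
  δᵉ 0 m +ℚ natℚ (suc n) *ℚ δᵉ 0 m
    ≡⟨ cong (_+ℚ natℚ (suc n) *ℚ δᵉ 0 m) (sym (ℚ.*-identityˡ (δᵉ 0 m))) ⟩
  1ℚ *ℚ δᵉ 0 m +ℚ natℚ (suc n) *ℚ δᵉ 0 m
    ≡⟨ sym (ℚ.*-distribʳ-+ (δᵉ 0 m) 1ℚ (natℚ (suc n))) ⟩
  natℚ (suc (suc n)) *ℚ δᵉ 0 m ∎
  where open ≡-Reasoning

shW-triangular : IsTriangular shW
shW-triangular = record
  { length-additive   = shW-length-additive
  ; depth-subadditive = shW-depth-subadditive
  ; H1-closed         = shW-H1-closed
  ; coeff-y^-leading  = λ u n u' m u∈H0 → coeff-shW-y^-leading u n u' m (H0⇒depth≡0 u u∈H0)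
  ; coeff-y-y^        = coeff-shW-y-y^
  }

-- The t-harmonic product is triangular

zeros : ℕ → List ℕ
zeros n = replicate n 0

fromZ-zeros : ∀ n → fromZ (zeros n) ≡ y^ n
fromZ-zeros zero = refl
fromZ-zeros (suc n) = cong (y ∷_) (fromZ-zeros n)

toZ-zw++ : ∀ k r a → toZ r ≡ just a → toZ (zw k ++ r) ≡ just (k ∷ a)
toZ-zw++ zero r a e rewrite e = refl
toZ-zw++ (suc k) r a e rewrite toZ-zw++ k r a e = refl

toZ-fromZ : ∀ a → toZ (fromZ a) ≡ just a
toZ-fromZ [] = refl
toZ-fromZ (k ∷ a) = toZ-zw++ k (fromZ a) a (toZ-fromZ a)

fromZ-toZ : ∀ w a → toZ w ≡ just a → fromZ a ≡ w
fromZ-toZ [] a refl = refl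
fromZ-toZ (y ∷ w) a e with toZ w in e′
fromZ-toZ (y ∷ w) _ refl | just a = cong (y ∷_) (fromZ-toZ w a e′)
fromZ-toZ (x ∷ w) a e with toZ w in e′
fromZ-toZ (x ∷ w) _ refl | just (k ∷ a) = cong (x ∷_) (fromZ-toZ w (k ∷ a) e′)

toZ-++y : ∀ u → ∃[ k ] ∃[ a ] (toZ (u ++ [ y ]) ≡ just (k ∷ a))
toZ-++y [] = 0 , [] , refl
toZ-++y (y ∷ u) with toZ-++y u
... | k , a , e rewrite e = 0 , k ∷ a , refl
toZ-++y (x ∷ u) with toZ-++y u
... | k , a , e rewrite e = suc k , a , refl

toZ-H1 : ∀ w → H1Word w → ∃[ a ] (toZ w ≡ just a)
toZ-H1 [] _ = [] , refl
toZ-H1 w (inj₂ (u , w≡u++y)) with toZ-++y u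
... | k , a , e = k ∷ a , trans (cong toZ w≡u++y) e

stW-fromZ : ∀ a b → stW (fromZ a) (fromZ b) ≡ stZ a b
stW-fromZ a b rewrite toZ-fromZ a | toZ-fromZ b = refl

AllWords-stW : (P : Word → Word → Word → Set) → (∀ a b → AllWords (P (fromZ a) (fromZ b)) (stZ a b)) →
               ∀ u v → AllWords (P u v) (stW u v)
AllWords-stW P h u v with toZ u in e₁ | toZ v in e₂
... | just a | just b = subst₂ (λ u v → AllWords (P u v) (stZ a b)) (fromZ-toZ u a e₁) (fromZ-toZ v b e₂) (h a b)
... | just _ | nothing = []
... | nothing | _ = []

AllWords-if : ∀ {p : Word → Set} c X → (c ≡ false → AllWords p X) → AllWords p (if c then [] else X)
AllWords-if true X _ = []
AllWords-if false X h = h refl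

AllWords-stZ : (P : List ℕ → List ℕ → Word → Set) →
  (∀ b → P [] b (fromZ b)) →
  (∀ k a → P (k ∷ a) [] (fromZ (k ∷ a))) →
  (∀ k a l b {w} → P a (l ∷ b) w → P (k ∷ a) (l ∷ b) (zw k ++ w)) →
  (∀ k a l b {w} → P (k ∷ a) b w → P (k ∷ a) (l ∷ b) (zw l ++ w)) →
  (∀ k a l b {w} → P a b w → P (k ∷ a) (l ∷ b) (zw (suc (k + l)) ++ w)) →
  (∀ k a l b {w} → (isNil a ∧ isNil b) ≡ false → P a b w →
     P (k ∷ a) (l ∷ b) (replicate (suc (suc (k + l))) x ++ w)) →
  ∀ a b → AllWords (P a b) (stZ a b)
AllWords-stZ P nilˡ nilʳ consˡ consʳ merge tail = go
  where
  go : ∀ a b → AllWords (P a b) (stZ a b)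
  go [] b = nilˡ b ∷ []
  go (k ∷ a) [] = nilʳ k a ∷ []
  go (k ∷ a) (l ∷ b) =
    AllWords-++ (AllWords-++ (AllWords-++ (AllWords-++
      (AllWords-prefix (zw k) (consˡ k a l b) (go a (l ∷ b)))
      (AllWords-prefix (zw l) (consʳ k a l b) (go (k ∷ a) b)))
      (AllWords-scale 1ℚ 0 merged))
      (AllWords-scale (- (1ℚ +ℚ 1ℚ)) 1 merged))
      (AllWords-if (isNil a ∧ isNil b) _ λ nonempty →
        AllWords-++ (AllWords-scale 1ℚ 2 (tailed nonempty)) (AllWords-scale (- 1ℚ) 1 (tailed nonempty)))
    where
    merged = AllWords-prefix (zw (suc (k + l))) (merge k a l b) (go a b)
    tailed = λ nonempty → AllWords-prefix (replicate (suc (suc (k + l))) x) (tail k a l b nonempty) (go a b)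

length-zw++ : ∀ k w → length (zw k ++ w) ≡ suc k + length w
length-zw++ k w = trans (List.length-++ (zw k)) (cong (_+ length w) (trans (List.length-++ (replicate k x))
                                                                           (trans (cong (_+ 1) (List.length-replicate k)) (ℕ.+-comm k 1))))

length-x^++ : ∀ n w → length (replicate n x ++ w) ≡ n + length w
length-x^++ n w = trans (List.length-++ (replicate n x)) (cong (_+ length w) (List.length-replicate n))

stZ-length-additive : ∀ a b → AllWords (λ w → length w ≡ length (fromZ a) + length (fromZ b)) (stZ a b)
stZ-length-additive = AllWords-stZ _
  (λ b → refl)
  (λ k a → sym (ℕ.+-identityʳ _))
  (λ k a l b {w} e → trans (length-zw++ k w)
                      (trans (cong (suc k +_) e)
                      (trans (sym (ℕ.+-assoc (suc k) _ _)) (cong (_+ _) (sym (length-zw++ k (fromZ a)))))))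
  (λ k a l b {w} e → trans (length-zw++ l w)
                      (trans (cong (suc l +_) e)
                      (trans (+-exchange l _ _) (cong (length (fromZ (k ∷ a)) +_) (sym (length-zw++ l (fromZ b)))))))
  (λ k a l b {w} e → trans (length-zw++ (suc (k + l)) w) (merged k a l b {w} e))
  (λ k a l b {w} _ e → trans (length-x^++ (suc (suc (k + l))) w) (merged k a l b {w} e))
  where
  +-exchange : ∀ l A B → suc l + (A + B) ≡ A + (suc l + B)
  +-exchange = solve-∀
  +-merge : ∀ k l A B → suc (suc (k + l)) + (A + B) ≡ (suc k + A) + (suc l + B)
  +-merge = solve-∀
  merged : ∀ k a l b {w} → length w ≡ length (fromZ a) + length (fromZ b) →
           suc (suc (k + l)) + length w ≡ length (fromZ (k ∷ a)) + length (fromZ (l ∷ b))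
  merged k a l b {w} e =
    trans (cong (suc (suc (k + l)) +_) e)
    (trans (+-merge k l _ _) (sym (cong₂ _+_ (length-zw++ k (fromZ a)) (length-zw++ l (fromZ b)))))

stZ-depth-subadditive : ∀ a b → AllWords (λ w → depth w ≤ depth (fromZ a) + depth (fromZ b)) (stZ a b)
stZ-depth-subadditive = AllWords-stZ _
  (λ b → ℕ.≤-refl)
  (λ k a → ℕ.≤-reflexive (sym (ℕ.+-identityʳ _)))
  consˡ consʳ (λ _ _ _ _ _ → z≤n) (λ _ _ _ _ _ _ → z≤n)
  where
  consˡ : ∀ k a l b {w} → depth w ≤ depth (fromZ a) + depth (fromZ (l ∷ b)) →
          depth (zw k ++ w) ≤ depth (fromZ (k ∷ a)) + depth (fromZ (l ∷ b))
  consˡ zero a l b le = s≤s le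
  consˡ (suc k) a l b le = z≤n
  consʳ : ∀ k a l b {w} → depth w ≤ depth (fromZ (k ∷ a)) + depth (fromZ b) →
          depth (zw l ++ w) ≤ depth (fromZ (k ∷ a)) + depth (fromZ (l ∷ b))
  consʳ k a zero b {w} le = subst (suc (depth w) ≤_) (sym (ℕ.+-suc _ (depth (fromZ b)))) (s≤s le)
  consʳ k a (suc l) b le = z≤n

zw++-EndsInY : ∀ k w → H1Word w → EndsInY (zw k ++ w)
zw++-EndsInY k w (inj₁ refl) = replicate k x , List.++-identityʳ (zw k)
zw++-EndsInY k w (inj₂ e) = EndsInY-++ (zw k) e

fromZ-H1 : ∀ a → H1Word (fromZ a)
fromZ-H1 [] = inj₁ refl
fromZ-H1 (k ∷ a) = inj₂ (zw++-EndsInY k (fromZ a) (fromZ-H1 a))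

stZ-H1 : ∀ a b → AllWords H1Word (stZ a b)
stZ-H1 a b = AllWords-map proj₂ (AllWords-stZ H1StZ
  (λ { [] → (λ ()) , inj₁ refl ; (l ∷ b) → ends [] (l ∷ b) (zw++-EndsInY l (fromZ b) (fromZ-H1 b)) })
  (λ k a → ends (k ∷ a) [] (zw++-EndsInY k (fromZ a) (fromZ-H1 a)))
  (λ k a l b ih → ends (k ∷ a) (l ∷ b) (zw++-EndsInY k _ (proj₂ ih)))
  (λ k a l b ih → ends (k ∷ a) (l ∷ b) (zw++-EndsInY l _ (proj₂ ih)))
  (λ k a l b ih → ends (k ∷ a) (l ∷ b) (zw++-EndsInY (suc (k + l)) _ (proj₂ ih)))
  (λ k a l b nonempty ih →
     ends (k ∷ a) (l ∷ b) (EndsInY-++ (replicate (suc (suc (k + l))) x) (proj₁ ih nonempty)))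
  a b)
  where
  H1StZ : List ℕ → List ℕ → Word → Set
  H1StZ a b w = ((isNil a ∧ isNil b) ≡ false → EndsInY w) × H1Word w
  ends : ∀ a b {w} → EndsInY w → H1StZ a b w
  ends a b e = (λ _ → e) , inj₂ e

coeff-stZ-at-y∷ : ∀ k a b w m →
  coeff (stZ (k ∷ a) (0 ∷ b)) (y ∷ w) m ≡
  coeff (prefix (zw k) (stZ a (0 ∷ b))) (y ∷ w) m +ℚ coeff (stZ (k ∷ a) b) w m
coeff-stZ-at-y∷ k a b w m =
  trans (coeff-⊕-nullʳ (((A ⊕ B) ⊕ C) ⊕ D) E (y ∷ w) m
          (coeff-StartsWithX-y∷ E w m (AllWords-if (isNil a ∧ isNil b) _ λ _ →
             AllWords-++ (AllWords-scale 1ℚ 2 (AllWords-prefix-x∷ _ (stZ a b)))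
                         (AllWords-scale (- 1ℚ) 1 (AllWords-prefix-x∷ _ (stZ a b))))))
  (trans (coeff-⊕-nullʳ ((A ⊕ B) ⊕ C) D (y ∷ w) m
          (coeff-StartsWithX-y∷ D w m (AllWords-scale (- (1ℚ +ℚ 1ℚ)) 1 (AllWords-prefix-x∷ _ (stZ a b)))))
  (trans (coeff-⊕-nullʳ (A ⊕ B) C (y ∷ w) m
          (coeff-StartsWithX-y∷ C w m (AllWords-scale 1ℚ 0 (AllWords-prefix-x∷ _ (stZ a b)))))
  (trans (coeff-++ A B (y ∷ w) m)
         (cong (coeff A (y ∷ w) m +ℚ_) (coeff-prefix [ y ] (stZ (k ∷ a) b) w m)))))
  where
  A = prefix (zw k) (stZ a (0 ∷ b))
  B = prefix (zw 0) (stZ (k ∷ a) b)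
  C = scale 1ℚ 0 (prefix (zw (suc (k + 0))) (stZ a b))
  D = scale (- (1ℚ +ℚ 1ℚ)) 1 (prefix (zw (suc (k + 0))) (stZ a b))
  E = if isNil a ∧ isNil b then [] else
        (scale 1ℚ 2 (prefix (replicate (suc (suc (k + 0))) x) (stZ a b))
         ⊕ scale (- 1ℚ) 1 (prefix (replicate (suc (suc (k + 0))) x) (stZ a b)))

coeff-stZ-y^-leading : ∀ a n u' m → depth (fromZ a) ≡ 0 →
                       coeff (stZ a (zeros n)) (y^ n ++ u') m ≡ δʷ (fromZ a) u' *ℚ δᵉ 0 m
coeff-stZ-y^-leading [] n u' m _ =
  trans (cong (λ v → coeff (monomial 1ℚ 0 v) (y^ n ++ u') m) (fromZ-zeros n)) (coeff-monomial-y^ n u' m)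
coeff-stZ-y^-leading (suc k ∷ a) zero u' m _ = coeff-monomial-1 0 (fromZ (suc k ∷ a)) u' m
coeff-stZ-y^-leading (suc k ∷ a) (suc n) u' m d≡0 =
  trans (coeff-stZ-at-y∷ (suc k) a (zeros n) (y^ n ++ u') m)
  (trans (cong (_+ℚ coeff (stZ (suc k ∷ a) (zeros n)) (y^ n ++ u') m)
               (coeff-StartsWithX-y∷ _ (y^ n ++ u') m (AllWords-prefix-x∷ (zw k) (stZ a (zeros (suc n))))))
  (trans (ℚ.+-identityˡ _) (coeff-stZ-y^-leading (suc k ∷ a) n u' m d≡0)))

coeff-stZ-y-y^ : ∀ n m → coeff (stZ [ 0 ] (zeros n)) (y^ (suc n)) m ≡ natℚ (suc n) *ℚ δᵉ 0 m
coeff-stZ-y-y^ zero m = coeff-shW-y-y^ zero m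
coeff-stZ-y-y^ (suc n) m = begin
  coeff (stZ [ 0 ] (zeros (suc n))) (y ∷ y^ (suc n)) m
    ≡⟨ coeff-stZ-at-y∷ 0 [] (zeros n) (y^ (suc n)) m ⟩
  coeff (prefix [ y ] (stZ [] (zeros (suc n)))) (y ∷ y^ (suc n)) m +ℚ coeff (stZ [ 0 ] (zeros n)) (y^ (suc n)) m
    ≡⟨ cong₂ _+ℚ_ (trans (coeff-prefix [ y ] (stZ [] (zeros (suc n))) (y^ (suc n)) m)
                         (trans (cong (λ v → coeff (monomial 1ℚ 0 v) (y^ (suc n)) m) (fromZ-zeros (suc n)))
                         (trans (coeff-monomial 1ℚ 0 (y^ (suc n)) (y^ (suc n)) m) (termCoeff-1-self 0 (y^ (suc n)) m))))
                  (coeff-stZ-y-y^ n m) ⟩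
  δᵉ 0 m +ℚ natℚ (suc n) *ℚ δᵉ 0 m
    ≡⟨ cong (_+ℚ natℚ (suc n) *ℚ δᵉ 0 m) (sym (ℚ.*-identityˡ (δᵉ 0 m))) ⟩
  1ℚ *ℚ δᵉ 0 m +ℚ natℚ (suc n) *ℚ δᵉ 0 m
    ≡⟨ sym (ℚ.*-distribʳ-+ (δᵉ 0 m) 1ℚ (natℚ (suc n))) ⟩
  natℚ (suc (suc n)) *ℚ δᵉ 0 m ∎
  where open ≡-Reasoning

stW-y^ : ∀ a n → stW (fromZ a) (y^ n) ≡ stZ a (zeros n)
stW-y^ a n = trans (cong (stW (fromZ a)) (sym (fromZ-zeros n))) (stW-fromZ a (zeros n))

coeff-stW-y^-leading : ∀ u n u' m → H0Word u → coeff (stW u (y^ n)) (y^ n ++ u') m ≡ δʷ u u' *ℚ δᵉ 0 m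
coeff-stW-y^-leading u n u' m u∈H0 with toZ-H1 u (H0⇒H1 u u∈H0)
... | a , toZu≡a = subst (λ v → coeff (stW v (y^ n)) (y^ n ++ u') m ≡ δʷ v u' *ℚ δᵉ 0 m) fromZa≡u
  (trans (cong (λ P → coeff P (y^ n ++ u') m) (stW-y^ a n))
         (coeff-stZ-y^-leading a n u' m (trans (cong depth fromZa≡u) (H0⇒depth≡0 u u∈H0))))
  where
  fromZa≡u : fromZ a ≡ u
  fromZa≡u = fromZ-toZ u a toZu≡a

stW-triangular : IsTriangular stW
stW-triangular = record
  { length-additive   = AllWords-stW _ stZ-length-additive
  ; depth-subadditive = AllWords-stW _ stZ-depth-subadditive
  ; H1-closed         = λ u v _ _ → AllWords-stW (λ _ _ → H1Word) stZ-H1 u v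
  ; coeff-y^-leading  = coeff-stW-y^-leading
  ; coeff-y-y^        = λ n m → trans (cong (λ P → coeff P (y^ (suc n)) m) (stW-y^ [ 0 ] n)) (coeff-stZ-y-y^ n m)
  }

lemma2p7 : H1IsPolyH0 _⧢_ × H1IsPolyH0 _⊛_
lemma2p7 = Triangular.H1-polynomial-in-y shW-triangular , Triangular.H1-polynomial-in-y stW-triangular
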